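{- Let $R_4(n)$ denote the number of reduced $4$-by-$n$ Latin rectangles on $\{1,\dots,n\}$, $n\ge1$. For integer vectors $t=(t_{abc})_{a,b,c\in\{0,1\}}$ define \begin{align*} &f_1=t_{000}+t_{010}+t_{001}+t_{011},\quad f_2=t_{000}+t_{100}+t_{001}+t_{101},\quad f_3=t_{000}+t_{100}+t_{010}+t_{110},\\ &f_{1,2}=t_{000}+t_{001},\quad f_{1,3}=t_{000}+t_{010},\quad f_{2,3}=t_{000}+t_{100},\quad f_{1,2,3}=t_{000}, \end{align*} and $g_4(t)=f_1f_2f_3-f_{1,2}f_3-f_{2,3}f_1-f_{1,3}f_2+2f_{1,2,3}$. For $\varepsilon\in\{0,1\}^3$ let $e_\varepsilon$ be the unit vector indexed by $\varepsilon$ and $|\varepsilon|$ the number of $1$'s in $\varepsilon$. Then \[ R_4(n)=\sum_{s}(-1)^{\sum_\varepsilon|\varepsilon|s_\varepsilon}\binom{n}{(s_\varepsilon)_{\varepsilon}}\prod_{\varepsilon\in\{0,1\}^3} g_4\big(s-e_\varepsilon+e_{111}\big)^{s_\varepsilon}, \] summed over all $s=(s_\varepsilon)_{\varepsilon\in\{0,1\}^3}$ of nonnegative integers with $\sum_\varepsilon s_\varepsilon=n$, where the binomial symbol is the multinomial coefficient and $x^0=1$ (including $0^0=1$).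
   Context: A $k$-by-$n$ Latin rectangle on $\{1,\dots,n\}$ is a $k\times n$ matrix with entries in $\{1,\dots,n\}$ such that no row and no column contains a repeated entry. It is reduced if its first row is $1,2,\dots,n$ in order. -}

module Defs where

open import Data.Bool using (Bool; true; false; _∧_; _∨_; not; T; if_then_else_)
open import Data.Product using (Σ; _×_; _,_)
open import Data.Nat as ℕ using (ℕ; zero; suc; _∸_; NonZero; _!)
open import Data.Nat.Properties using (_!≢0; m*n≢0)
open import Data.Bool.ListAction using (any; all)
import Data.Nat.Base as ℕB
open import Data.Integer as ℤ using (ℤ; +_; _+_; _-_; _*_; _^_; -_)
open import Data.Fin as Fin using (Fin)
open import Data.Fin.Properties using (_≟_)
open import Data.List as List using (List; []; _∷_; map; concatMap; upTo; allFin)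
open import Data.Vec as Vec using (Vec; lookup)
open import Relation.Nullary.Decidable using (⌊_⌋)

-- a k-by-n matrix with entries in Fin n (= {1..n} shifted to {0..n-1}),
-- stored as k rows, each a vector of length n
Matrix : ℕ → ℕ → Set
Matrix k n = Vec (Vec (Fin n) n) k

distinct : ∀ {n} → List (Fin n) → Bool
distinct []       = true
distinct (x ∷ xs) = not (any (λ y → ⌊ x ≟ y ⌋) xs) ∧ distinct xs

rowsDistinct : ∀ {k n} → Matrix k n → Bool
rowsDistinct M = all (λ i → distinct (Vec.toList (lookup M i))) (allFin _)

columnsDistinct : ∀ {k n} → Matrix k n → Bool
columnsDistinct {n = n} M =
  all (λ j → distinct (Vec.toList (Vec.map (λ row → lookup row j) M))) (allFin n)

isLatin : ∀ {k n} → Matrix k n → Bool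
isLatin M = rowsDistinct M ∧ columnsDistinct M

firstRowIdentity : ∀ {k n} → Matrix k n → Bool
firstRowIdentity {zero}  M = true
firstRowIdentity {suc k} {n} M =
  all (λ j → ⌊ lookup (Vec.head M) j ≟ j ⌋) (allFin n)

isReducedLatin : ∀ {k n} → Matrix k n → Bool
isReducedLatin M = isLatin M ∧ firstRowIdentity M

-- the set of reduced k-by-n Latin rectangles (predicate is a T of a Bool,
-- hence proof-irrelevant, so this is an honest subset of matrices)
ReducedLatinRect : ℕ → ℕ → Set
ReducedLatinRect k n = Σ (Matrix k n) (λ M → T (isReducedLatin M))

Eps : Set
Eps = Bool × Bool × Bool

allEps : List Eps
allEps = concatMap (λ a → concatMap (λ b → map (λ c → a , b , c) bs) bs) bs
  where bs = false ∷ true ∷ []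

b2ℕ : Bool → ℕ
b2ℕ false = 0
b2ℕ true  = 1

weight : Eps → ℕ
weight (a , b , c) = b2ℕ a ℕ.+ b2ℕ b ℕ.+ b2ℕ c

eqEps : Eps → Eps → Bool
eqEps (a , b , c) (a' , b' , c') = eqB a a' ∧ eqB b b' ∧ eqB c c'
  where
  eqB : Bool → Bool → Bool
  eqB true  true  = true
  eqB false false = true
  eqB _     _     = false

e111 : Eps
e111 = true , true , true

unit : Eps → Eps → ℤ
unit ε ε' = if eqEps ε ε' then + 1 else + 0

-- g_4(t); components t_{abc} written t (a , b , c), false = 0, true = 1
g4 : (Eps → ℤ) → ℤ
g4 t = f1 * f2 * f3 - f12 * f3 - f23 * f1 - f13 * f2 + + 2 * f123
  where
  t000 = t (false , false , false)
  t100 = t (true  , false , false)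
  t010 = t (false , true  , false)
  t001 = t (false , false , true )
  t110 = t (true  , true  , false)
  t101 = t (true  , false , true )
  t011 = t (false , true  , true )
  f1 = t000 + t010 + t001 + t011
  f2 = t000 + t100 + t001 + t101
  f3 = t000 + t100 + t010 + t110
  f12 = t000 + t001
  f13 = t000 + t010
  f23 = t000 + t100
  f123 = t000

compositions : (k n : ℕ) → List (Vec ℕ k)
compositions zero    zero    = Vec.[] ∷ []
compositions zero    (suc n) = []
compositions (suc k) n =
  concatMap (λ i → map (i Vec.∷_) (compositions k (n ∸ i))) (upTo (suc n))

code : Eps → Fin 8
code (false , false , false) = Fin.fromℕ< {0} (ℕB.s≤s ℕB.z≤n)
code (false , false , true ) = Fin.fromℕ< {1} (ℕB.s≤s (ℕB.s≤s ℕB.z≤n))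
code (false , true  , false) = Fin.fromℕ< {2} (ℕB.s≤s (ℕB.s≤s (ℕB.s≤s ℕB.z≤n)))
code (false , true  , true ) = Fin.fromℕ< {3} (ℕB.s≤s (ℕB.s≤s (ℕB.s≤s (ℕB.s≤s ℕB.z≤n))))
code (true  , false , false) = Fin.fromℕ< {4} (ℕB.s≤s (ℕB.s≤s (ℕB.s≤s (ℕB.s≤s (ℕB.s≤s ℕB.z≤n)))))
code (true  , false , true ) = Fin.fromℕ< {5} (ℕB.s≤s (ℕB.s≤s (ℕB.s≤s (ℕB.s≤s (ℕB.s≤s (ℕB.s≤s ℕB.z≤n))))))
code (true  , true  , false) = Fin.fromℕ< {6} (ℕB.s≤s (ℕB.s≤s (ℕB.s≤s (ℕB.s≤s (ℕB.s≤s (ℕB.s≤s (ℕB.s≤s ℕB.z≤n)))))))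
code (true  , true  , true ) = Fin.fromℕ< {7} (ℕB.s≤s (ℕB.s≤s (ℕB.s≤s (ℕB.s≤s (ℕB.s≤s (ℕB.s≤s (ℕB.s≤s (ℕB.s≤s ℕB.z≤n))))))))

toEpsVec : Vec ℕ 8 → (Eps → ℕ)
toEpsVec v ε = lookup v (code ε)

sRange : ℕ → List (Eps → ℕ)
sRange n = map toEpsVec (compositions 8 n)

sumℕ : List ℕ → ℕ
sumℕ = List.foldr ℕ._+_ 0

sumℤ : List ℤ → ℤ
sumℤ = List.foldr _+_ (+ 0)

prodℤ : List ℤ → ℤ
prodℤ = List.foldr _*_ (+ 1)

prodFact : List ℕ → ℕ
prodFact = List.foldr (λ a r → a ! ℕ.* r) 1

prodFact≢0 : ∀ xs → NonZero (prodFact xs)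
prodFact≢0 []       = _
prodFact≢0 (x ∷ xs) = m*n≢0 (x !) (prodFact xs) {{x !≢0}} {{prodFact≢0 xs}}

multinomial : ℕ → (Eps → ℕ) → ℕ
multinomial n s = (n ! ℕ./ prodFact (map s allEps)) {{prodFact≢0 (map s allEps)}}

summand : ℕ → (Eps → ℕ) → ℤ
summand n s =
  ((- + 1) ^ sumℕ (map (λ ε → weight ε ℕ.* s ε) allEps))
  * (+ multinomial n s)
  * prodℤ (map (λ ε → g4 (λ ε' → + s ε' - unit ε ε' + unit e111 ε') ^ s ε) allEps)

rhsR4 : ℕ → ℤ
rhsR4 n = sumℤ (map (summand n) (sRange n))

{-# OPTIONS --safe #-}
module Submission where

-- With the first row fixed to the identity, a reduced 4 × n Latin rectangle is a triple of
-- permutations r₂, r₃, r₄ of Fin n such that j, r₂ j, r₃ j, r₄ j are distinct in every column j.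
-- A row is a permutation iff it is onto, and inclusion–exclusion over the values missed by the
-- three rows is indexed by a word τ over {0,1}³ of length n whose letter τ k records which rows
-- must miss k, with sign (-1)^(Σₖ |τ k|).  For fixed τ the sum over the rows factors over the
-- columns; in column j it runs over triples a, b, c that are distinct and different from j, and
-- inclusion–exclusion over the coincidences among a, b, c evaluates it to g₄(s − e_{τ j} + e₁₁₁),
-- where s counts the letters of τ.  So each word contributes a quantity depending only on s, and
-- there are multinomial(n; s) words with letter counts s.

open import Defs
open import Data.Nat using (ℕ; _≤_)
open import Data.Integer using (+_)
open import Data.Fin using (Fin)
open import Data.Product using (Σ; _×_)
open import Function.Bundles using (_↔_)
open import Relation.Binary.PropositionalEquality using (_≡_)

open import Data.Bool using (Bool; true; false; T; not; _∧_)
open import Data.Bool.ListAction using (all; any)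
open import Data.Bool.Properties using (T-∧; ∧-assoc)
open import Data.Fin using (zero; suc; punchOut)
open import Data.Fin.Properties
  using (_≟_; 0↔⊥; 1↔⊤; +↔⊎; any?; suc-injective; 0≢1+n; punchOut-injective; ¬Fin0; injective⇒≤)
open import Data.Integer using (ℤ; _+_; _*_; _-_; -_; _^_; -1ℤ)
import Data.Integer.Properties as ℤ
open import Data.Integer.Tactic.RingSolver using (solve-∀)
open import Data.List as List using (List; []; _∷_; _++_; map; concatMap; filterᵇ; allFin; upTo)
open import Data.List.Membership.Propositional using (lose)
open import Data.List.Membership.Propositional.Properties using (∈-allFin)
import Data.List.Properties as List
import Data.List.Relation.Unary.All as All
open import Data.List.Relation.Unary.All.Properties using (all⁺; all⁻)
open import Data.List.Relation.Unary.Any using (satisfied)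
open import Data.List.Relation.Unary.Any.Properties using (any⁺; any⁻)
open import Data.Nat as ℕ using (zero; suc; _!; _∸_; _≡ᵇ_; _<ᵇ_; _<_; s≤s; z≤n)
import Data.Nat.DivMod as DivMod
open import Data.Nat.ListAction.Properties using (sum-++)
import Data.Nat.Properties as ℕ
open import Data.Product using (_,_; proj₁; proj₂; ∃)
open import Data.Product.Function.Dependent.Propositional using (Σ-↔)
open import Data.Product.Function.NonDependent.Propositional using (_×-⇔_)
open import Data.Sum using (_⊎_; inj₁; inj₂)
open import Data.Sum.Function.Propositional using (_⊎-↔_)
open import Data.Unit using (tt)
open import Data.Vec as Vec using (Vec; []; _∷_; lookup)
import Data.Vec.Properties as Vec
open import Function.Base using (_∘_; id)
open import Function.Bundles using (mk↔ₛ′; _⇔_; mk⇔; Equivalence)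
open import Function.Definitions using (Injective)
import Function.Properties.Equivalence as ⇔
open import Function.Properties.Inverse using (↔-refl; ↔-sym; ↔-trans)
open import Relation.Binary.PropositionalEquality
  using (refl; sym; trans; cong; cong₂; subst; _≢_; module ≡-Reasoning)
open import Relation.Nullary.Decidable using (⌊_⌋; yes; no; toWitness; fromWitness)
open import Relation.Nullary.Negation using (¬_; contradiction)

private
  variable
    A B : Set

𝟙 : Bool → ℤ
𝟙 b = + b2ℕ b

𝟙-∧ : ∀ a b → 𝟙 (a ∧ b) ≡ 𝟙 a * 𝟙 b
𝟙-∧ false b = refl
𝟙-∧ true  b = sym (ℤ.*-identityˡ (𝟙 b))

𝟙-not : ∀ b → 𝟙 (not b) ≡ + 1 - 𝟙 b
𝟙-not false = refl
𝟙-not true  = refl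

𝟙-idem : ∀ b → 𝟙 b * 𝟙 b ≡ 𝟙 b
𝟙-idem false = refl
𝟙-idem true  = refl

𝟙-⇔ : ∀ {a b} → T a ⇔ T b → 𝟙 a ≡ 𝟙 b
𝟙-⇔ {false} {false} _   = refl
𝟙-⇔ {true}  {true}  _   = refl
𝟙-⇔ {false} {true}  a⇔b = contradiction _ (Equivalence.from a⇔b)
𝟙-⇔ {true}  {false} a⇔b = contradiction _ (Equivalence.to a⇔b)

𝟙-T : ∀ {b} → T b → 𝟙 b ≡ + 1
𝟙-T {true} _ = refl

T-not : ∀ {b} → T (not b) ⇔ (¬ T b)
T-not {false} = mk⇔ (λ _ ()) _
T-not {true}  = mk⇔ (λ ()) (λ ¬t → ¬t _)

∑ : List A → (A → ℤ) → ℤ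
∑ xs f = sumℤ (map f xs)

∏ : List A → (A → ℤ) → ℤ
∏ xs f = prodℤ (map f xs)

infix 5 ∑ ∏
syntax ∑ xs (λ x → e) = ∑[ x ∈ xs ] e
syntax ∏ xs (λ x → e) = ∏[ x ∈ xs ] e

∑-cong : ∀ (xs : List A) {f g : A → ℤ} → (∀ x → f x ≡ g x) → ∑ xs f ≡ ∑ xs g
∑-cong []       f≗g = refl
∑-cong (x ∷ xs) f≗g = cong₂ _+_ (f≗g x) (∑-cong xs f≗g)

∏-cong : ∀ (xs : List A) {f g : A → ℤ} → (∀ x → f x ≡ g x) → ∏ xs f ≡ ∏ xs g
∏-cong []       f≗g = refl
∏-cong (x ∷ xs) f≗g = cong₂ _*_ (f≗g x) (∏-cong xs f≗g)

∑-++ : ∀ (xs ys : List A) f → ∑ (xs ++ ys) f ≡ ∑ xs f + ∑ ys f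
∑-++ []       ys f = sym (ℤ.+-identityˡ (∑ ys f))
∑-++ (x ∷ xs) ys f = trans (cong (_+_ (f x)) (∑-++ xs ys f)) (sym (ℤ.+-assoc (f x) _ _))

∑-map : ∀ (g : A → B) xs f → ∑ (map g xs) f ≡ ∑[ x ∈ xs ] f (g x)
∑-map g xs f = cong sumℤ (sym (List.map-∘ xs))

∑-concatMap : ∀ (g : A → List B) xs f → ∑ (concatMap g xs) f ≡ ∑[ x ∈ xs ] ∑ (g x) f
∑-concatMap g []       f = refl
∑-concatMap g (x ∷ xs) f =
  trans (∑-++ (g x) (concatMap g xs) f) (cong (_+_ (∑ (g x) f)) (∑-concatMap g xs f))

∑-distrib-+ : ∀ (xs : List A) f g → ∑[ x ∈ xs ] (f x + g x) ≡ ∑ xs f + ∑ xs g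
∑-distrib-+ []       f g = refl
∑-distrib-+ (x ∷ xs) f g = begin
  (f x + g x) + (∑[ y ∈ xs ] (f y + g y)) ≡⟨ cong (_+_ (f x + g x)) (∑-distrib-+ xs f g) ⟩
  (f x + g x) + (∑ xs f + ∑ xs g)       ≡⟨ interchange (f x) (g x) _ _ ⟩
  (f x + ∑ xs f) + (g x + ∑ xs g)       ∎
  where
  open ≡-Reasoning
  interchange : ∀ a b c d → (a + b) + (c + d) ≡ (a + c) + (b + d)
  interchange = solve-∀

∑-distribˡ : ∀ c (xs : List A) f → c * ∑ xs f ≡ ∑[ x ∈ xs ] (c * f x)
∑-distribˡ c []       f = ℤ.*-zeroʳ c
∑-distribˡ c (x ∷ xs) f =
  trans (ℤ.*-distribˡ-+ c (f x) (∑ xs f)) (cong (_+_ (c * f x)) (∑-distribˡ c xs f))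

∑-distribʳ : ∀ c (xs : List A) f → ∑ xs f * c ≡ ∑[ x ∈ xs ] (f x * c)
∑-distribʳ c []       f = ℤ.*-zeroˡ c
∑-distribʳ c (x ∷ xs) f =
  trans (ℤ.*-distribʳ-+ c (f x) (∑ xs f)) (cong (_+_ (f x * c)) (∑-distribʳ c xs f))

∑-zero : ∀ (xs : List A) → ∑[ x ∈ xs ] + 0 ≡ + 0
∑-zero []       = refl
∑-zero (x ∷ xs) = trans (ℤ.+-identityˡ _) (∑-zero xs)

∑-comm : ∀ (xs : List A) (ys : List B) (f : A → B → ℤ) →
         ∑[ x ∈ xs ] ∑[ y ∈ ys ] f x y ≡ ∑[ y ∈ ys ] ∑[ x ∈ xs ] f x y
∑-comm []       ys f = sym (∑-zero ys)
∑-comm (x ∷ xs) ys f =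
  trans (cong (_+_ (∑ ys (f x))) (∑-comm xs ys f)) (sym (∑-distrib-+ ys (f x) _))

∑³ : List A → (A → A → A → ℤ) → ℤ
∑³ xs F = ∑[ a ∈ xs ] ∑[ b ∈ xs ] ∑[ c ∈ xs ] F a b c

∑²-cong : ∀ (xs : List A) {F G : A → A → ℤ} → (∀ a b → F a b ≡ G a b) →
          ∑[ a ∈ xs ] ∑[ b ∈ xs ] F a b ≡ ∑[ a ∈ xs ] ∑[ b ∈ xs ] G a b
∑²-cong xs F≗G = ∑-cong xs (λ a → ∑-cong xs (F≗G a))

∑³-cong : ∀ (xs : List A) {F G : A → A → A → ℤ} → (∀ a b c → F a b c ≡ G a b c) → ∑³ xs F ≡ ∑³ xs G
∑³-cong xs F≗G = ∑²-cong xs (λ a b → ∑-cong xs (F≗G a b))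

∑³-distrib-+ : ∀ (xs : List A) F G → ∑³ xs (λ a b c → F a b c + G a b c) ≡ ∑³ xs F + ∑³ xs G
∑³-distrib-+ xs F G = trans (∑²-cong xs (λ a b → ∑-distrib-+ xs (F a b) (G a b)))
  (trans (∑-cong xs (λ a → ∑-distrib-+ xs (λ b → ∑ xs (F a b)) (λ b → ∑ xs (G a b))))
         (∑-distrib-+ xs (λ a → ∑[ b ∈ xs ] ∑ xs (F a b)) (λ a → ∑[ b ∈ xs ] ∑ xs (G a b))))

∑³-distribˡ : ∀ k (xs : List A) F → k * ∑³ xs F ≡ ∑³ xs (λ a b c → k * F a b c)
∑³-distribˡ k xs F = trans (∑-distribˡ k xs (λ a → ∑[ b ∈ xs ] ∑ xs (F a b)))
  (∑-cong xs (λ a → trans (∑-distribˡ k xs (λ b → ∑ xs (F a b))) (∑-cong xs (λ b → ∑-distribˡ k xs (F a b)))))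

∑³-∑-comm : ∀ (xs : List A) (ys : List B) (F : A → A → A → B → ℤ) →
            ∑³ xs (λ a b c → ∑[ y ∈ ys ] F a b c y) ≡ ∑[ y ∈ ys ] ∑³ xs (λ a b c → F a b c y)
∑³-∑-comm xs ys F = begin
  ∑³ xs (λ a b c → ∑[ y ∈ ys ] F a b c y)
    ≡⟨ ∑²-cong xs (λ a b → ∑-comm xs ys (F a b)) ⟩
  ∑[ a ∈ xs ] ∑[ b ∈ xs ] ∑[ y ∈ ys ] ∑[ c ∈ xs ] F a b c y
    ≡⟨ ∑-cong xs (λ a → ∑-comm xs ys (λ b y → ∑[ c ∈ xs ] F a b c y)) ⟩
  ∑[ a ∈ xs ] ∑[ y ∈ ys ] ∑[ b ∈ xs ] ∑[ c ∈ xs ] F a b c y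
    ≡⟨ ∑-comm xs ys (λ a y → ∑[ b ∈ xs ] ∑[ c ∈ xs ] F a b c y) ⟩
  ∑[ y ∈ ys ] ∑³ xs (λ a b c → F a b c y) ∎
  where open ≡-Reasoning

∏-distrib-* : ∀ (xs : List A) f g → ∏[ x ∈ xs ] (f x * g x) ≡ ∏ xs f * ∏ xs g
∏-distrib-* []       f g = refl
∏-distrib-* (x ∷ xs) f g =
  trans (cong (f x * g x *_) (∏-distrib-* xs f g)) (interchange (f x) (g x) _ _)
  where
  interchange : ∀ a b c d → (a * b) * (c * d) ≡ (a * c) * (b * d)
  interchange = solve-∀

∏-distrib-*³ : ∀ (xs : List A) f g h → ∏[ x ∈ xs ] (f x * g x * h x) ≡ ∏ xs f * ∏ xs g * ∏ xs h
∏-distrib-*³ xs f g h =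
  trans (∏-distrib-* xs (λ x → f x * g x) h) (cong (_* ∏ xs h) (∏-distrib-* xs f g))

+-sum : ∀ (xs : List A) (f : A → ℕ) → + sumℕ (map f xs) ≡ ∑[ x ∈ xs ] + f x
+-sum []       f = refl
+-sum (x ∷ xs) f = trans (ℤ.pos-+ (f x) _) (cong (_+_ (+ f x)) (+-sum xs f))

𝟙-all : ∀ (p : A → Bool) xs → 𝟙 (all p xs) ≡ ∏[ x ∈ xs ] 𝟙 (p x)
𝟙-all p []       = refl
𝟙-all p (x ∷ xs) = trans (𝟙-∧ (p x) _) (cong (𝟙 (p x) *_) (𝟙-all p xs))

∑-filterᵇ : ∀ (p : A → Bool) xs (f : A → ℤ) → ∑[ x ∈ xs ] (𝟙 (p x) * f x) ≡ ∑ (filterᵇ p xs) f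
∑-filterᵇ p []       f = refl
∑-filterᵇ p (x ∷ xs) f with p x
... | true  = cong₂ _+_ (ℤ.*-identityˡ (f x)) (∑-filterᵇ p xs f)
... | false = trans (ℤ.+-identityˡ _) (∑-filterᵇ p xs f)

∏-filterᵇ : ∀ (p : A → Bool) xs (f : A → ℤ) → ∏[ x ∈ xs ] (f x ^ b2ℕ (p x)) ≡ ∏ (filterᵇ p xs) f
∏-filterᵇ p []       f = refl
∏-filterᵇ p (x ∷ xs) f with p x
... | true  = cong₂ _*_ (ℤ.*-identityʳ (f x)) (∏-filterᵇ p xs f)
... | false = trans (ℤ.*-identityˡ _) (∏-filterᵇ p xs f)

map-allFin-suc : ∀ n (f : Fin (suc n) → A) →
                 map f (allFin (suc n)) ≡ f zero ∷ map (f ∘ suc) (allFin n)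
map-allFin-suc n f =
  cong (f zero ∷_) (trans (List.map-tabulate suc f) (sym (List.map-tabulate id (f ∘ suc))))

∑-allFin-suc : ∀ n (f : Fin (suc n) → ℤ) → ∑ (allFin (suc n)) f ≡ f zero + (∑[ i ∈ allFin n ] f (suc i))
∑-allFin-suc n f = cong sumℤ (map-allFin-suc n f)

∏-allFin-suc : ∀ n (f : Fin (suc n) → ℤ) → ∏ (allFin (suc n)) f ≡ f zero * (∏[ i ∈ allFin n ] f (suc i))
∏-allFin-suc n f = cong prodℤ (map-allFin-suc n f)

δ : ∀ {n} → Fin n → Fin n → ℤ
δ x y = 𝟙 ⌊ x ≟ y ⌋

≟-sym : ∀ {n} (x y : Fin n) → ⌊ x ≟ y ⌋ ≡ ⌊ y ≟ x ⌋
≟-sym x y with x ≟ y | y ≟ x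
... | yes _   | yes _   = refl
... | no  _   | no  _   = refl
... | yes x≡y | no  y≢x = contradiction (sym x≡y) y≢x
... | no  x≢y | yes y≡x = contradiction (sym y≡x) x≢y

suc≟suc : ∀ {n} (x y : Fin n) → ⌊ suc x ≟ suc y ⌋ ≡ ⌊ x ≟ y ⌋
suc≟suc x y with x ≟ y
... | yes _ = refl
... | no  _ = refl

∑-δ : ∀ {n} (x : Fin n) (f : Fin n → ℤ) → ∑[ y ∈ allFin n ] (δ x y * f y) ≡ f x
∑-δ {suc n} zero f = begin
  ∑[ y ∈ allFin (suc n) ] (δ zero y * f y)  ≡⟨ ∑-allFin-suc n (λ y → δ zero y * f y) ⟩
  + 1 * f zero + (∑[ y ∈ allFin n ] + 0)    ≡⟨ cong₂ _+_ (ℤ.*-identityˡ (f zero)) (∑-zero (allFin n)) ⟩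
  f zero + + 0                              ≡⟨ ℤ.+-identityʳ (f zero) ⟩
  f zero                                    ∎
  where open ≡-Reasoning
∑-δ {suc n} (suc x) f =
  trans (∑-allFin-suc n (λ y → δ (suc x) y * f y)) (trans (ℤ.+-identityˡ _)
    (trans (∑-cong (allFin n) (λ y → cong (λ b → 𝟙 b * f (suc y)) (suc≟suc x y))) (∑-δ x (f ∘ suc))))

eqEps-sound : ∀ x y → T (eqEps x y) → x ≡ y
eqEps-sound = sound
  where
  -- Once the first coordinates agree, eqEps (a , p) (a , q) reduces to the comparison of the
  -- tails, whatever a is; tail-sound states this for a = false.
  last-sound : ∀ c c′ → T (eqEps (false , false , c) (false , false , c′)) → c ≡ c′
  last-sound false false _ = refl
  last-sound true  true  _ = refl
  tail-sound : ∀ p q → T (eqEps (false , p) (false , q)) → p ≡ q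
  tail-sound (false , c) (false , c′) eq = cong (false ,_) (last-sound c c′ eq)
  tail-sound (true  , c) (true  , c′) eq = cong (true  ,_) (last-sound c c′ eq)
  sound : ∀ x y → T (eqEps x y) → x ≡ y
  sound (false , p) (false , q) eq = cong (false ,_) (tail-sound p q eq)
  sound (true  , p) (true  , q) eq = cong (true  ,_) (tail-sound p q eq)

filterᵇ-eqEps : ∀ x → filterᵇ (eqEps x) allEps ≡ x ∷ []
filterᵇ-eqEps (false , false , false) = refl
filterᵇ-eqEps (false , false , true ) = refl
filterᵇ-eqEps (false , true  , false) = refl
filterᵇ-eqEps (false , true  , true ) = refl
filterᵇ-eqEps (true  , false , false) = refl
filterᵇ-eqEps (true  , false , true ) = refl
filterᵇ-eqEps (true  , true  , false) = refl
filterᵇ-eqEps (true  , true  , true ) = refl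

∑-eqEps : ∀ x (f : Eps → ℤ) → ∑[ ε ∈ allEps ] (𝟙 (eqEps x ε) * f ε) ≡ f x
∑-eqEps x f = begin
  ∑[ ε ∈ allEps ] (𝟙 (eqEps x ε) * f ε) ≡⟨ ∑-filterᵇ (eqEps x) allEps f ⟩
  ∑ (filterᵇ (eqEps x) allEps) f         ≡⟨ cong (λ εs → ∑ εs f) (filterᵇ-eqEps x) ⟩
  f x + + 0                              ≡⟨ ℤ.+-identityʳ (f x) ⟩
  f x                                    ∎
  where open ≡-Reasoning

∏-eqEps : ∀ x (f : Eps → ℤ) → ∏[ ε ∈ allEps ] (f ε ^ b2ℕ (eqEps x ε)) ≡ f x
∏-eqEps x f = begin
  ∏[ ε ∈ allEps ] (f ε ^ b2ℕ (eqEps x ε)) ≡⟨ ∏-filterᵇ (eqEps x) allEps f ⟩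
  ∏ (filterᵇ (eqEps x) allEps) f          ≡⟨ cong (λ εs → ∏ εs f) (filterᵇ-eqEps x) ⟩
  f x * + 1                               ≡⟨ ℤ.*-identityʳ (f x) ⟩
  f x                                     ∎
  where open ≡-Reasoning

allVecs : List A → (n : ℕ) → List (Vec A n)
allVecs xs zero    = [] ∷ []
allVecs xs (suc n) = concatMap (λ x → map (x ∷_) (allVecs xs n)) xs

-- xs lists every element of A exactly once: a family of blocks of
-- sizes f x can be laid out along xs.
Enumerates : List A → Set
Enumerates {A} xs = ∀ (f : A → ℕ) → Σ A (λ x → Fin (f x)) ↔ Fin (sumℕ (map f xs))

sumℕ-concatMap : ∀ (g : A → List B) (f : B → ℕ) xs →
                 sumℕ (map f (concatMap g xs)) ≡ sumℕ (map (λ x → sumℕ (map f (g x))) xs)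
sumℕ-concatMap g f []       = refl
sumℕ-concatMap g f (x ∷ xs) = begin
  sumℕ (map f (g x ++ concatMap g xs))                ≡⟨ cong sumℕ (List.map-++ f (g x) _) ⟩
  sumℕ (map f (g x) ++ map f (concatMap g xs))        ≡⟨ sum-++ (map f (g x)) _ ⟩
  sumℕ (map f (g x)) ℕ.+ sumℕ (map f (concatMap g xs)) ≡⟨ cong (sumℕ (map f (g x)) ℕ.+_) (sumℕ-concatMap g f xs) ⟩
  sumℕ (map (λ y → sumℕ (map f (g y))) (x ∷ xs))      ∎
  where open ≡-Reasoning

Fin-cong-↔ : ∀ {m n} → m ≡ n → Fin m ↔ Fin n
Fin-cong-↔ refl = ↔-refl

Σ-Fin-suc-↔ : ∀ {n} (P : Fin (suc n) → Set) → Σ (Fin (suc n)) P ↔ (P zero ⊎ Σ (Fin n) (P ∘ suc))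
Σ-Fin-suc-↔ P = mk↔ₛ′
  (λ { (zero , p) → inj₁ p ; (suc i , p) → inj₂ (i , p) })
  (λ { (inj₁ p) → zero , p ; (inj₂ (i , p)) → suc i , p })
  (λ { (inj₁ p) → refl ; (inj₂ (i , p)) → refl })
  (λ { (zero , p) → refl ; (suc i , p) → refl })

allFin-enumerates : ∀ n → Enumerates (allFin n)
allFin-enumerates zero    f = mk↔ₛ′ (λ { (() , _) }) (λ ()) (λ ()) (λ { (() , _) })
allFin-enumerates (suc n) f =
  ↔-trans (Σ-Fin-suc-↔ (Fin ∘ f))
  (↔-trans (↔-refl ⊎-↔ allFin-enumerates n (f ∘ suc))
  (↔-trans (↔-sym +↔⊎)
           (Fin-cong-↔ (cong sumℕ (sym (map-allFin-suc n f))))))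

allVecs-enumerates : ∀ {xs : List A} → Enumerates xs → ∀ n → Enumerates (allVecs xs n)
allVecs-enumerates xs-enum zero    f = ↔-trans
  (mk↔ₛ′ (λ { ([] , i) → i }) (λ i → [] , i) (λ _ → refl) (λ { ([] , i) → refl }))
  (Fin-cong-↔ (sym (ℕ.+-identityʳ (f []))))
allVecs-enumerates {xs = xs} xs-enum (suc n) f =
  ↔-trans uncons-↔
  (↔-trans (Σ-↔ ↔-refl (λ {x} → allVecs-enumerates xs-enum n (f ∘ (x ∷_))))
  (↔-trans (xs-enum (λ x → sumℕ (map (f ∘ (x ∷_)) (allVecs xs n))))
           (Fin-cong-↔ (sym sum-split))))
  where
  sum-split : sumℕ (map f (allVecs xs (suc n))) ≡ sumℕ (map (λ x → sumℕ (map (f ∘ (x ∷_)) (allVecs xs n))) xs)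
  sum-split = trans (sumℕ-concatMap _ f xs)
                    (cong sumℕ (List.map-cong (λ x → cong sumℕ (sym (List.map-∘ (allVecs xs n)))) xs))
  uncons-↔ : Σ (Vec _ (suc n)) (Fin ∘ f) ↔ Σ _ (λ x → Σ (Vec _ n) (Fin ∘ f ∘ (x ∷_)))
  uncons-↔ = mk↔ₛ′ (λ { ((x ∷ v) , i) → x , v , i }) (λ { (x , v , i) → (x ∷ v) , i })
                   (λ _ → refl) (λ { ((x ∷ v) , i) → refl })

T↔Fin : ∀ b → T b ↔ Fin (b2ℕ b)
T↔Fin false = ↔-sym 0↔⊥
T↔Fin true  = ↔-sym 1↔⊤

Σ-T↔Fin-count : ∀ {xs : List A} → Enumerates xs → (p : A → Bool) →
                Σ A (T ∘ p) ↔ Fin (sumℕ (map (b2ℕ ∘ p) xs))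
Σ-T↔Fin-count xs-enum p = ↔-trans (Σ-↔ ↔-refl (λ {x} → T↔Fin (p x))) (xs-enum (b2ℕ ∘ p))

∑-allVecs-suc : ∀ (xs : List A) n (F : Vec A (suc n) → ℤ) →
                ∑ (allVecs xs (suc n)) F ≡ ∑[ x ∈ xs ] ∑[ v ∈ allVecs xs n ] F (x ∷ v)
∑-allVecs-suc xs n F = trans (∑-concatMap _ xs F) (∑-cong xs (λ x → ∑-map (x ∷_) (allVecs xs n) F))

∑-∏-allVecs : ∀ (xs : List A) n (w : Fin n → A → ℤ) →
              ∑[ v ∈ allVecs xs n ] ∏[ j ∈ allFin n ] w j (lookup v j) ≡ ∏[ j ∈ allFin n ] ∑ xs (w j)
∑-∏-allVecs xs zero    w = refl
∑-∏-allVecs xs (suc n) w = begin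
  ∑[ v ∈ allVecs xs (suc n) ] ∏[ j ∈ allFin (suc n) ] w j (lookup v j)
    ≡⟨ ∑-allVecs-suc xs n _ ⟩
  ∑[ x ∈ xs ] ∑[ v ∈ allVecs xs n ] ∏[ j ∈ allFin (suc n) ] w j (lookup (x ∷ v) j)
    ≡⟨ ∑-cong xs (λ x → ∑-cong (allVecs xs n) (λ v → ∏-allFin-suc n (λ j → w j (lookup (x ∷ v) j)))) ⟩
  ∑[ x ∈ xs ] ∑[ v ∈ allVecs xs n ] (w zero x * Π′ v)
    ≡⟨ ∑-cong xs (λ x → sym (∑-distribˡ (w zero x) (allVecs xs n) Π′)) ⟩
  ∑[ x ∈ xs ] (w zero x * ∑ (allVecs xs n) Π′)
    ≡⟨ sym (∑-distribʳ (∑ (allVecs xs n) Π′) xs (w zero)) ⟩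
  ∑ xs (w zero) * ∑ (allVecs xs n) Π′
    ≡⟨ cong (∑ xs (w zero) *_) (∑-∏-allVecs xs n (w ∘ suc)) ⟩
  ∑ xs (w zero) * (∏[ j ∈ allFin n ] ∑ xs (w (suc j)))
    ≡⟨ sym (∏-allFin-suc n (λ j → ∑ xs (w j))) ⟩
  ∏[ j ∈ allFin (suc n) ] ∑ xs (w j) ∎
  where
  open ≡-Reasoning
  Π′ : Vec _ n → ℤ
  Π′ v = ∏[ j ∈ allFin n ] w (suc j) (lookup v j)

∑³-∏-allVecs : ∀ (xs : List A) n (w : Fin n → A → A → A → ℤ) →
  ∑³ (allVecs xs n) (λ u v t → ∏[ j ∈ allFin n ] w j (lookup u j) (lookup v j) (lookup t j))
  ≡ ∏[ j ∈ allFin n ] ∑³ xs (w j)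
∑³-∏-allVecs xs n w =
  trans (∑²-cong (allVecs xs n) (λ u v → ∑-∏-allVecs xs n (λ j → w j (lookup u j) (lookup v j))))
  (trans (∑-cong (allVecs xs n) (λ u → ∑-∏-allVecs xs n (λ j b → ∑ xs (w j (lookup u j) b))))
         (∑-∏-allVecs xs n (λ j a → ∑[ b ∈ xs ] ∑ xs (w j a b))))

∑-δ-allVecs : ∀ {m n} (c : Vec (Fin m) n) (G : Vec (Fin m) n → ℤ) →
              ∑[ v ∈ allVecs (allFin m) n ] ((∏[ j ∈ allFin n ] δ (lookup v j) (lookup c j)) * G v) ≡ G c
∑-δ-allVecs [] G = trans (ℤ.+-identityʳ _) (ℤ.*-identityˡ (G []))
∑-δ-allVecs {m} {suc n} (c₀ ∷ c) G = begin
  ∑[ v ∈ allVecs (allFin m) (suc n) ] (δᵥ (c₀ ∷ c) v * G v)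
    ≡⟨ ∑-allVecs-suc (allFin m) n _ ⟩
  ∑[ x ∈ allFin m ] ∑[ v ∈ allVecs (allFin m) n ] (δᵥ (c₀ ∷ c) (x ∷ v) * G (x ∷ v))
    ≡⟨ ∑-cong (allFin m) (λ x → ∑-cong (allVecs (allFin m) n) (λ v → split x v)) ⟩
  ∑[ x ∈ allFin m ] ∑[ v ∈ allVecs (allFin m) n ] (δ c₀ x * (δᵥ c v * G (x ∷ v)))
    ≡⟨ ∑-cong (allFin m) (λ x → sym (∑-distribˡ (δ c₀ x) (allVecs (allFin m) n) _)) ⟩
  ∑[ x ∈ allFin m ] (δ c₀ x * (∑[ v ∈ allVecs (allFin m) n ] (δᵥ c v * G (x ∷ v))))
    ≡⟨ ∑-δ c₀ (λ x → ∑[ v ∈ allVecs (allFin m) n ] (δᵥ c v * G (x ∷ v))) ⟩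
  ∑[ v ∈ allVecs (allFin m) n ] (δᵥ c v * G (c₀ ∷ v))
    ≡⟨ ∑-δ-allVecs c (G ∘ (c₀ ∷_)) ⟩
  G (c₀ ∷ c) ∎
  where
  open ≡-Reasoning
  δᵥ : ∀ {k} → Vec (Fin m) k → Vec (Fin m) k → ℤ
  δᵥ {k} c v = ∏[ j ∈ allFin k ] δ (lookup v j) (lookup c j)
  split : ∀ x v → δᵥ (c₀ ∷ c) (x ∷ v) * G (x ∷ v) ≡ δ c₀ x * (δᵥ c v * G (x ∷ v))
  split x v = begin
    δᵥ (c₀ ∷ c) (x ∷ v) * G (x ∷ v)
      ≡⟨ cong (_* G (x ∷ v)) (∏-allFin-suc n (λ j → δ (lookup (x ∷ v) j) (lookup (c₀ ∷ c) j))) ⟩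
    δ x c₀ * δᵥ c v * G (x ∷ v)
      ≡⟨ ℤ.*-assoc (δ x c₀) _ _ ⟩
    δ x c₀ * (δᵥ c v * G (x ∷ v))
      ≡⟨ cong (λ b → 𝟙 b * (δᵥ c v * G (x ∷ v))) (≟-sym x c₀) ⟩
    δ c₀ x * (δᵥ c v * G (x ∷ v)) ∎

-- A row is a permutation iff it is onto

T-all-allFin : ∀ {n} (p : Fin n → Bool) → T (all p (allFin n)) ⇔ (∀ i → T (p i))
T-all-allFin {n} p = mk⇔ (λ t i → All.lookup (all⁺ p (allFin n) t) (∈-allFin i))
                         (λ h → all⁻ p {xs = allFin n} (All.tabulate λ {i} _ → h i))

T-any-allFin : ∀ {n} (p : Fin n → Bool) → T (any p (allFin n)) ⇔ ∃ (T ∘ p)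
T-any-allFin {n} p = mk⇔ (λ t → satisfied (any⁻ p (allFin n) t))
                         (λ { (i , pᵢ) → any⁺ p (lose (∈-allFin i) pᵢ) })

distinctRow : ∀ {m n} → Vec (Fin n) m → Bool
distinctRow r = distinct (Vec.toList r)

T-not-any-≟ : ∀ {m n} (x : Fin n) (r : Vec (Fin n) m) →
              T (not (any (λ y → ⌊ x ≟ y ⌋) (Vec.toList r))) ⇔ (∀ j → x ≢ lookup r j)
T-not-any-≟ x []      = mk⇔ (λ _ ()) _
T-not-any-≟ x (y ∷ r) with x ≟ y
... | yes x≡y = mk⇔ (λ ()) (λ x∉r → x∉r zero x≡y)
... | no  x≢y = mk⇔ (λ t → λ { zero → x≢y ; (suc j) → Equivalence.to (T-not-any-≟ x r) t j })
                    (λ x∉r → Equivalence.from (T-not-any-≟ x r) (x∉r ∘ suc))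

Injective-∷ : ∀ {m n} (x : Fin n) (r : Vec (Fin n) m) →
              Injective _≡_ _≡_ (lookup (x ∷ r)) ⇔ ((∀ j → x ≢ lookup r j) × Injective _≡_ _≡_ (lookup r))
Injective-∷ x r = mk⇔ to from
  where
  to : Injective _≡_ _≡_ (lookup (x ∷ r)) → (∀ j → x ≢ lookup r j) × Injective _≡_ _≡_ (lookup r)
  to inj = (λ j x≡rⱼ → 0≢1+n (inj {zero} {suc j} x≡rⱼ)) , λ rᵢ≡rⱼ → suc-injective (inj rᵢ≡rⱼ)
  from : (∀ j → x ≢ lookup r j) × Injective _≡_ _≡_ (lookup r) → Injective _≡_ _≡_ (lookup (x ∷ r))
  from (x∉r , inj) {zero}  {zero}  _ = refl
  from (x∉r , inj) {zero}  {suc j} e = contradiction e (x∉r j)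
  from (x∉r , inj) {suc i} {zero}  e = contradiction (sym e) (x∉r i)
  from (x∉r , inj) {suc i} {suc j} e = cong suc (inj e)

distinct⇔injective : ∀ {m n} (r : Vec (Fin n) m) → T (distinctRow r) ⇔ Injective _≡_ _≡_ (lookup r)
distinct⇔injective []      = mk⇔ (λ _ {i} → contradiction i ¬Fin0) _
distinct⇔injective (x ∷ r) =
  ⇔.trans T-∧ (⇔.trans (T-not-any-≟ x r ×-⇔ distinct⇔injective r) (⇔.sym (Injective-∷ x r)))

-- If k were missed, punching k out of the codomain would inject Fin (suc m) into Fin m.
injective⇒onto : ∀ {n} {f : Fin n → Fin n} → Injective _≡_ _≡_ f → ∀ k → ∃ λ j → f j ≡ k
injective⇒onto {suc m} {f} inj k with any? (λ j → f j ≟ k)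
... | yes hit = hit
... | no  miss = contradiction (injective⇒≤ punched-injective) ℕ.1+n≰n
  where
  k≢f : ∀ j → k ≢ f j
  k≢f j k≡fⱼ = miss (j , sym k≡fⱼ)
  punched : Fin (suc m) → Fin m
  punched j = punchOut (k≢f j)
  punched-injective : Injective _≡_ _≡_ punched
  punched-injective e = inj (punchOut-injective (k≢f _) (k≢f _) e)

-- A right inverse g of f is injective, hence onto, which makes it a two-sided inverse.
onto⇒injective : ∀ {n} {f : Fin n → Fin n} → (∀ k → ∃ λ j → f j ≡ k) → Injective _≡_ _≡_ f
onto⇒injective {f = f} onto {i} {j} fᵢ≡fⱼ = begin
  i        ≡⟨ sym (proj₂ (g-onto i)) ⟩
  g (a i)  ≡⟨ cong g aᵢ≡aⱼ ⟩
  g (a j)  ≡⟨ proj₂ (g-onto j) ⟩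
  j        ∎
  where
  open ≡-Reasoning
  g : _ → _
  g k = proj₁ (onto k)
  f∘g : ∀ k → f (g k) ≡ k
  f∘g k = proj₂ (onto k)
  g-onto = injective⇒onto {f = g} λ {k} {l} gₖ≡gₗ → trans (sym (f∘g k)) (trans (cong f gₖ≡gₗ) (f∘g l))
  a : _ → _
  a x = proj₁ (g-onto x)
  aᵢ≡aⱼ : a i ≡ a j
  aᵢ≡aⱼ = begin
    a i          ≡⟨ sym (f∘g (a i)) ⟩
    f (g (a i))  ≡⟨ cong f (proj₂ (g-onto i)) ⟩
    f i          ≡⟨ fᵢ≡fⱼ ⟩
    f j          ≡⟨ cong f (sym (proj₂ (g-onto j))) ⟩
    f (g (a j))  ≡⟨ f∘g (a j) ⟩
    a j          ∎

inImage : ∀ {m n} → Vec (Fin n) m → Fin n → Bool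
inImage {m} r k = any (λ j → ⌊ lookup r j ≟ k ⌋) (allFin m)

𝟙-distinct≡∏-inImage : ∀ {n} (r : Vec (Fin n) n) →
                       𝟙 (distinctRow r) ≡ ∏[ k ∈ allFin n ] 𝟙 (inImage r k)
𝟙-distinct≡∏-inImage {n} r = trans (𝟙-⇔ distinct⇔all-inImage) (𝟙-all (inImage r) (allFin n))
  where
  onto⇔all-inImage : (∀ k → ∃ λ j → lookup r j ≡ k) ⇔ (∀ k → T (inImage r k))
  onto⇔all-inImage = mk⇔
    (λ onto k → Equivalence.from (T-any-allFin _) (proj₁ (onto k) , fromWitness (proj₂ (onto k))))
    (λ hit k → let j , t = Equivalence.to (T-any-allFin _) (hit k) in j , toWitness t)
  distinct⇔all-inImage : T (distinctRow r) ⇔ T (all (inImage r) (allFin n))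
  distinct⇔all-inImage =
    ⇔.trans (distinct⇔injective r)
    (⇔.trans (mk⇔ injective⇒onto onto⇒injective)
    (⇔.trans onto⇔all-inImage (⇔.sym (T-all-allFin (inImage r)))))

-- Inclusion–exclusion over the values missed by three rows

π₁ π₂ π₃ : Eps → Bool
π₁ (a , _ , _) = a
π₂ (_ , b , _) = b
π₃ (_ , _ , c) = c

sign : Eps → ℤ
sign ε = (- + 1) ^ weight ε

inclusion-exclusion³ : ∀ x y z →
  𝟙 x * 𝟙 y * 𝟙 z ≡ ∑[ ε ∈ allEps ] (sign ε * (𝟙 (not (π₁ ε ∧ x)) * 𝟙 (not (π₂ ε ∧ y)) * 𝟙 (not (π₃ ε ∧ z))))
inclusion-exclusion³ false false false = refl
inclusion-exclusion³ false false true  = refl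
inclusion-exclusion³ false true  false = refl
inclusion-exclusion³ false true  true  = refl
inclusion-exclusion³ true  false false = refl
inclusion-exclusion³ true  false true  = refl
inclusion-exclusion³ true  true  false = refl
inclusion-exclusion³ true  true  true  = refl

∏-avoid-inImage : ∀ {m n} (B : Fin n → Bool) (r : Vec (Fin n) m) →
  ∏[ k ∈ allFin n ] 𝟙 (not (B k ∧ inImage r k)) ≡ ∏[ j ∈ allFin m ] 𝟙 (not (B (lookup r j)))
∏-avoid-inImage {m} {n} B r = begin
  ∏[ k ∈ allFin n ] 𝟙 (not (B k ∧ inImage r k))
    ≡⟨ sym (𝟙-all _ (allFin n)) ⟩
  𝟙 (all (λ k → not (B k ∧ inImage r k)) (allFin n))
    ≡⟨ 𝟙-⇔ (⇔.trans (T-all-allFin _) (⇔.trans (mk⇔ to from) (⇔.sym (T-all-allFin _)))) ⟩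
  𝟙 (all (λ j → not (B (lookup r j))) (allFin m))
    ≡⟨ 𝟙-all _ (allFin m) ⟩
  ∏[ j ∈ allFin m ] 𝟙 (not (B (lookup r j))) ∎
  where
  open ≡-Reasoning
  hit : ∀ j → T (inImage r (lookup r j))
  hit j = Equivalence.from (T-any-allFin _) (j , fromWitness refl)
  to : (∀ k → T (not (B k ∧ inImage r k))) → ∀ j → T (not (B (lookup r j)))
  to avoid j = Equivalence.from T-not λ Bʳʲ →
    Equivalence.to T-not (avoid (lookup r j)) (Equivalence.from T-∧ (Bʳʲ , hit j))
  from : (∀ j → T (not (B (lookup r j)))) → ∀ k → T (not (B k ∧ inImage r k))
  from avoid k = Equivalence.from T-not λ t →
    let Bᵏ , k∈im = Equivalence.to T-∧ t
        j , rⱼ≡k = Equivalence.to (T-any-allFin _) k∈im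
    in Equivalence.to T-not (avoid j) (subst (T ∘ B) (sym (toWitness rⱼ≡k)) Bᵏ)

off₁ off₂ off₃ : Eps → Bool
off₁ = not ∘ π₁
off₂ = not ∘ π₂
off₃ = not ∘ π₃

-- Coordinate i of τ k records whether row i + 1 is required to miss the value k.
allowed : ∀ {n} → Vec Eps n → Fin n → Fin n → Fin n → ℤ
allowed τ a b c = 𝟙 (off₁ (lookup τ a)) * 𝟙 (off₂ (lookup τ b)) * 𝟙 (off₃ (lookup τ c))

sgn : ∀ {n} → Vec Eps n → ℤ
sgn {n} τ = ∏[ k ∈ allFin n ] sign (lookup τ k)

inclusion-exclusion-rows : ∀ {n} (r₂ r₃ r₄ : Vec (Fin n) n) →
  𝟙 (distinctRow r₂) * 𝟙 (distinctRow r₃) * 𝟙 (distinctRow r₄)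
  ≡ ∑[ τ ∈ allVecs allEps n ] (sgn τ * (∏[ j ∈ allFin n ] allowed τ (lookup r₂ j) (lookup r₃ j) (lookup r₄ j)))
inclusion-exclusion-rows {n} r₂ r₃ r₄ = begin
  𝟙 (distinctRow r₂) * 𝟙 (distinctRow r₃) * 𝟙 (distinctRow r₄)
    ≡⟨ cong₂ _*_ (cong₂ _*_ (𝟙-distinct≡∏-inImage r₂) (𝟙-distinct≡∏-inImage r₃)) (𝟙-distinct≡∏-inImage r₄) ⟩
  (∏[ k ∈ allFin n ] 𝟙 (inImage r₂ k)) * (∏[ k ∈ allFin n ] 𝟙 (inImage r₃ k))
    * (∏[ k ∈ allFin n ] 𝟙 (inImage r₄ k))
    ≡⟨ sym (∏-distrib-*³ (allFin n) _ _ _) ⟩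
  ∏[ k ∈ allFin n ] (𝟙 (inImage r₂ k) * 𝟙 (inImage r₃ k) * 𝟙 (inImage r₄ k))
    ≡⟨ ∏-cong (allFin n) (λ k → inclusion-exclusion³ (inImage r₂ k) (inImage r₃ k) (inImage r₄ k)) ⟩
  ∏[ k ∈ allFin n ] ∑[ ε ∈ allEps ] (sign ε * avoid k ε)
    ≡⟨ sym (∑-∏-allVecs allEps n (λ k ε → sign ε * avoid k ε)) ⟩
  ∑[ τ ∈ allVecs allEps n ] ∏[ k ∈ allFin n ] (sign (lookup τ k) * avoid k (lookup τ k))
    ≡⟨ ∑-cong (allVecs allEps n) (λ τ → trans (∏-distrib-* (allFin n) _ _) (cong (sgn τ *_) (avoid≡allowed τ))) ⟩
  ∑[ τ ∈ allVecs allEps n ] (sgn τ * (∏[ j ∈ allFin n ] allowed τ (lookup r₂ j) (lookup r₃ j) (lookup r₄ j))) ∎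
  where
  open ≡-Reasoning
  avoid : Fin n → Eps → ℤ
  avoid k ε = 𝟙 (not (π₁ ε ∧ inImage r₂ k)) * 𝟙 (not (π₂ ε ∧ inImage r₃ k)) * 𝟙 (not (π₃ ε ∧ inImage r₄ k))
  avoid≡allowed : ∀ τ → ∏[ k ∈ allFin n ] avoid k (lookup τ k)
                      ≡ ∏[ j ∈ allFin n ] allowed τ (lookup r₂ j) (lookup r₃ j) (lookup r₄ j)
  avoid≡allowed τ = begin
    ∏[ k ∈ allFin n ] avoid k (lookup τ k)
      ≡⟨ ∏-distrib-*³ (allFin n) _ _ _ ⟩
    (∏[ k ∈ allFin n ] 𝟙 (not (π₁ (lookup τ k) ∧ inImage r₂ k)))
      * (∏[ k ∈ allFin n ] 𝟙 (not (π₂ (lookup τ k) ∧ inImage r₃ k)))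
      * (∏[ k ∈ allFin n ] 𝟙 (not (π₃ (lookup τ k) ∧ inImage r₄ k)))
      ≡⟨ cong₂ _*_ (cong₂ _*_ (∏-avoid-inImage (π₁ ∘ lookup τ) r₂) (∏-avoid-inImage (π₂ ∘ lookup τ) r₃))
                   (∏-avoid-inImage (π₃ ∘ lookup τ) r₄) ⟩
    (∏[ j ∈ allFin n ] 𝟙 (off₁ (lookup τ (lookup r₂ j))))
      * (∏[ j ∈ allFin n ] 𝟙 (off₂ (lookup τ (lookup r₃ j))))
      * (∏[ j ∈ allFin n ] 𝟙 (off₃ (lookup τ (lookup r₄ j))))
      ≡⟨ sym (∏-distrib-*³ (allFin n) _ _ _) ⟩
    ∏[ j ∈ allFin n ] allowed τ (lookup r₂ j) (lookup r₃ j) (lookup r₄ j) ∎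

-- Column sums

𝟙-not-any : ∀ (p : A → Bool) xs → 𝟙 (not (any p xs)) ≡ ∏[ x ∈ xs ] 𝟙 (not (p x))
𝟙-not-any p []       = refl
𝟙-not-any p (x ∷ xs) with p x
... | true  = refl
... | false = trans (𝟙-not-any p xs) (sym (ℤ.*-identityˡ _))

𝟙-distinct-∷ : ∀ {n} (x : Fin n) xs → 𝟙 (distinct (x ∷ xs)) ≡ (∏[ y ∈ xs ] 𝟙 (not ⌊ x ≟ y ⌋)) * 𝟙 (distinct xs)
𝟙-distinct-∷ x xs = trans (𝟙-∧ (not (any _ xs)) (distinct xs)) (cong (_* 𝟙 (distinct xs)) (𝟙-not-any _ xs))

-- Möbius inversion over the partitions of {a, b, c}; the one-block partition has μ = 2.
𝟙-distinct³ : ∀ {n} (a b c : Fin n) →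
              𝟙 (distinct (a ∷ b ∷ c ∷ [])) ≡ + 1 - δ a b - δ b c - δ a c + + 2 * (δ a b * δ b c)
𝟙-distinct³ a b c with a ≟ b | b ≟ c | a ≟ c
... | yes _   | yes _   | yes _   = refl
... | yes a≡b | yes b≡c | no  a≢c = contradiction (trans a≡b b≡c) a≢c
... | yes a≡b | no  b≢c | yes a≡c = contradiction (trans (sym a≡b) a≡c) b≢c
... | yes _   | no  _   | no  _   = refl
... | no  a≢b | yes b≡c | yes a≡c = contradiction (trans a≡c (sym b≡c)) a≢b
... | no  _   | yes _   | no  _   = refl
... | no  _   | no  _   | yes _   = refl
... | no  _   | no  _   | no  _   = refl

g4-form : ℤ → ℤ → ℤ → ℤ → ℤ → ℤ → ℤ → ℤ
g4-form f₁ f₂ f₃ f₁₂ f₁₃ f₂₃ f₁₂₃ = f₁ * f₂ * f₃ - f₁₂ * f₃ - f₂₃ * f₁ - f₁₃ * f₂ + + 2 * f₁₂₃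

module _ {n : ℕ} (α β γ : Fin n → ℤ) where
  private
    I : List (Fin n)
    I = allFin n

    S : (Fin n → ℤ) → ℤ
    S = ∑ I

    P : Fin n → Fin n → Fin n → ℤ
    P a b c = α a * β b * γ c

    ∑³-P : ∑³ I P ≡ S α * S β * S γ
    ∑³-P = begin
      ∑³ I P
        ≡⟨ ∑²-cong I (λ a b → sym (∑-distribˡ (α a * β b) I γ)) ⟩
      ∑[ a ∈ I ] ∑[ b ∈ I ] (α a * β b * S γ)
        ≡⟨ ∑-cong I (λ a → sym (∑-distribʳ (S γ) I (λ b → α a * β b))) ⟩
      ∑[ a ∈ I ] ((∑[ b ∈ I ] (α a * β b)) * S γ)
        ≡⟨ ∑-cong I (λ a → cong (_* S γ) (sym (∑-distribˡ (α a) I β))) ⟩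
      ∑[ a ∈ I ] (α a * S β * S γ)
        ≡⟨ sym (∑-distribʳ (S γ) I (λ a → α a * S β)) ⟩
      (∑[ a ∈ I ] (α a * S β)) * S γ
        ≡⟨ cong (_* S γ) (sym (∑-distribʳ (S β) I α)) ⟩
      S α * S β * S γ ∎
      where open ≡-Reasoning

    ∑³-Pδab : ∑³ I (λ a b c → P a b c * δ a b) ≡ S (λ a → α a * β a) * S γ
    ∑³-Pδab = begin
      ∑³ I (λ a b c → P a b c * δ a b)
        ≡⟨ ∑³-cong I (λ a b c → shuffle (α a) (β b) (γ c) (δ a b)) ⟩
      ∑³ I (λ a b c → δ a b * (α a * β b) * γ c)
        ≡⟨ ∑²-cong I (λ a b → sym (∑-distribˡ (δ a b * (α a * β b)) I γ)) ⟩
      ∑[ a ∈ I ] ∑[ b ∈ I ] (δ a b * (α a * β b) * S γ)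
        ≡⟨ ∑²-cong I (λ a b → ℤ.*-assoc (δ a b) (α a * β b) (S γ)) ⟩
      ∑[ a ∈ I ] ∑[ b ∈ I ] (δ a b * (α a * β b * S γ))
        ≡⟨ ∑-cong I (λ a → ∑-δ a (λ b → α a * β b * S γ)) ⟩
      ∑[ a ∈ I ] (α a * β a * S γ)
        ≡⟨ sym (∑-distribʳ (S γ) I (λ a → α a * β a)) ⟩
      S (λ a → α a * β a) * S γ ∎
      where
      open ≡-Reasoning
      shuffle : ∀ x y z d → x * y * z * d ≡ d * (x * y) * z
      shuffle = solve-∀

    ∑³-Pδbc : ∑³ I (λ a b c → P a b c * δ b c) ≡ S (λ b → β b * γ b) * S α
    ∑³-Pδbc = begin
      ∑³ I (λ a b c → P a b c * δ b c)
        ≡⟨ ∑³-cong I (λ a b c → shuffle (α a) (β b) (γ c) (δ b c)) ⟩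
      ∑³ I (λ a b c → δ b c * (α a * β b * γ c))
        ≡⟨ ∑²-cong I (λ a b → ∑-δ b (λ c → α a * β b * γ c)) ⟩
      ∑[ a ∈ I ] ∑[ b ∈ I ] (α a * β b * γ b)
        ≡⟨ ∑²-cong I (λ a b → ℤ.*-assoc (α a) (β b) (γ b)) ⟩
      ∑[ a ∈ I ] ∑[ b ∈ I ] (α a * (β b * γ b))
        ≡⟨ ∑-cong I (λ a → sym (∑-distribˡ (α a) I (λ b → β b * γ b))) ⟩
      ∑[ a ∈ I ] (α a * S (λ b → β b * γ b))
        ≡⟨ sym (∑-distribʳ (S (λ b → β b * γ b)) I α) ⟩
      S α * S (λ b → β b * γ b)
        ≡⟨ ℤ.*-comm (S α) _ ⟩
      S (λ b → β b * γ b) * S α ∎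
      where
      open ≡-Reasoning
      shuffle : ∀ x y z d → x * y * z * d ≡ d * (x * y * z)
      shuffle = solve-∀

    ∑³-Pδac : ∑³ I (λ a b c → P a b c * δ a c) ≡ S (λ a → α a * γ a) * S β
    ∑³-Pδac = begin
      ∑³ I (λ a b c → P a b c * δ a c)
        ≡⟨ ∑³-cong I (λ a b c → shuffle (α a) (β b) (γ c) (δ a c)) ⟩
      ∑³ I (λ a b c → δ a c * (α a * γ c * β b))
        ≡⟨ ∑²-cong I (λ a b → ∑-δ a (λ c → α a * γ c * β b)) ⟩
      ∑[ a ∈ I ] ∑[ b ∈ I ] (α a * γ a * β b)
        ≡⟨ ∑-cong I (λ a → sym (∑-distribˡ (α a * γ a) I β)) ⟩
      ∑[ a ∈ I ] (α a * γ a * S β)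
        ≡⟨ sym (∑-distribʳ (S β) I (λ a → α a * γ a)) ⟩
      S (λ a → α a * γ a) * S β ∎
      where
      open ≡-Reasoning
      shuffle : ∀ x y z d → x * y * z * d ≡ d * (x * z * y)
      shuffle = solve-∀

    ∑³-Pδabδbc : ∑³ I (λ a b c → P a b c * (δ a b * δ b c)) ≡ S (λ a → α a * β a * γ a)
    ∑³-Pδabδbc = begin
      ∑³ I (λ a b c → P a b c * (δ a b * δ b c))
        ≡⟨ ∑³-cong I (λ a b c → shuffle (α a) (β b) (γ c) (δ a b) (δ b c)) ⟩
      ∑³ I (λ a b c → δ b c * (δ a b * (α a * β b * γ c)))
        ≡⟨ ∑²-cong I (λ a b → ∑-δ b (λ c → δ a b * (α a * β b * γ c))) ⟩
      ∑[ a ∈ I ] ∑[ b ∈ I ] (δ a b * (α a * β b * γ b))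
        ≡⟨ ∑-cong I (λ a → ∑-δ a (λ b → α a * β b * γ b)) ⟩
      S (λ a → α a * β a * γ a) ∎
      where
      open ≡-Reasoning
      shuffle : ∀ x y z d e → x * y * z * (d * e) ≡ e * (d * (x * y * z))
      shuffle = solve-∀

  ∑-distinct-triples :
    ∑³ (allFin n) (λ a b c → α a * β b * γ c * 𝟙 (distinct (a ∷ b ∷ c ∷ [])))
    ≡ g4-form (S α) (S β) (S γ) (S (λ a → α a * β a)) (S (λ a → α a * γ a)) (S (λ a → β a * γ a))
              (S (λ a → α a * β a * γ a))
  ∑-distinct-triples = begin
    ∑³ I (λ a b c → P a b c * 𝟙 (distinct (a ∷ b ∷ c ∷ [])))
      ≡⟨ ∑³-cong I (λ a b c → trans (cong (P a b c *_) (𝟙-distinct³ a b c))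
                                    (expand (P a b c) (δ a b) (δ b c) (δ a c))) ⟩
    ∑³ I (λ a b c → P a b c + (-1ℤ * (P a b c * δ a b) + (-1ℤ * (P a b c * δ b c)
                     + (-1ℤ * (P a b c * δ a c) + + 2 * (P a b c * (δ a b * δ b c))))))
      ≡⟨ ∑³-distrib-+ I _ _ ⟩
    ∑³ I P + ∑³ I (λ a b c → -1ℤ * (P a b c * δ a b) + (-1ℤ * (P a b c * δ b c)
                     + (-1ℤ * (P a b c * δ a c) + + 2 * (P a b c * (δ a b * δ b c)))))
      ≡⟨ cong (_+_ (∑³ I P))
           (trans (∑³-distrib-+ I _ _) (cong₂ _+_ (sym (∑³-distribˡ -1ℤ I _))
           (trans (∑³-distrib-+ I _ _) (cong₂ _+_ (sym (∑³-distribˡ -1ℤ I _))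
           (trans (∑³-distrib-+ I _ _) (cong₂ _+_ (sym (∑³-distribˡ -1ℤ I _))
                                                 (sym (∑³-distribˡ (+ 2) I _)))))))) ⟩
    ∑³ I P + (-1ℤ * ∑³ I (λ a b c → P a b c * δ a b) + (-1ℤ * ∑³ I (λ a b c → P a b c * δ b c)
                   + (-1ℤ * ∑³ I (λ a b c → P a b c * δ a c) + + 2 * ∑³ I (λ a b c → P a b c * (δ a b * δ b c)))))
      ≡⟨ cong₂ _+_ ∑³-P (cong₂ _+_ (cong (-1ℤ *_) ∑³-Pδab) (cong₂ _+_ (cong (-1ℤ *_) ∑³-Pδbc)
           (cong₂ _+_ (cong (-1ℤ *_) ∑³-Pδac) (cong (+ 2 *_) ∑³-Pδabδbc)))) ⟩
    S α * S β * S γ + (-1ℤ * (S (λ a → α a * β a) * S γ) + (-1ℤ * (S (λ b → β b * γ b) * S α)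
                    + (-1ℤ * (S (λ a → α a * γ a) * S β) + + 2 * S (λ a → α a * β a * γ a))))
      ≡⟨ collect (S α) (S β) (S γ) (S (λ a → α a * β a)) (S (λ a → α a * γ a)) (S (λ a → β a * γ a))
                 (S (λ a → α a * β a * γ a)) ⟩
    g4-form (S α) (S β) (S γ) (S (λ a → α a * β a)) (S (λ a → α a * γ a)) (S (λ a → β a * γ a))
            (S (λ a → α a * β a * γ a)) ∎
    where
    open ≡-Reasoning
    expand : ∀ p x y z → p * (+ 1 - x - y - z + + 2 * (x * y))
                       ≡ p + (-1ℤ * (p * x) + (-1ℤ * (p * y) + (-1ℤ * (p * z) + + 2 * (p * (x * y)))))
    expand = solve-∀
    collect : ∀ f₁ f₂ f₃ f₁₂ f₁₃ f₂₃ f₁₂₃ →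
              f₁ * f₂ * f₃ + (-1ℤ * (f₁₂ * f₃) + (-1ℤ * (f₂₃ * f₁) + (-1ℤ * (f₁₃ * f₂) + + 2 * f₁₂₃)))
              ≡ f₁ * f₂ * f₃ - f₁₂ * f₃ - f₂₃ * f₁ - f₁₃ * f₂ + + 2 * f₁₂₃
    collect = solve-∀

cnt : ∀ {n} → Vec Eps n → Eps → ℕ
cnt []      ε = 0
cnt (x ∷ τ) ε = b2ℕ (eqEps x ε) ℕ.+ cnt τ ε

∑-lookup : ∀ {n} (τ : Vec Eps n) (f : Eps → ℤ) →
           ∑[ a ∈ allFin n ] f (lookup τ a) ≡ ∑[ ε ∈ allEps ] (+ cnt τ ε * f ε)
∑-lookup []          f = refl
∑-lookup {suc n} (x ∷ τ) f = begin
  ∑[ a ∈ allFin (suc n) ] f (lookup (x ∷ τ) a)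
    ≡⟨ ∑-allFin-suc n (f ∘ lookup (x ∷ τ)) ⟩
  f x + (∑[ a ∈ allFin n ] f (lookup τ a))
    ≡⟨ cong₂ _+_ (sym (∑-eqEps x f)) (∑-lookup τ f) ⟩
  (∑[ ε ∈ allEps ] (𝟙 (eqEps x ε) * f ε)) + (∑[ ε ∈ allEps ] (+ cnt τ ε * f ε))
    ≡⟨ sym (∑-distrib-+ allEps (λ ε → 𝟙 (eqEps x ε) * f ε) (λ ε → + cnt τ ε * f ε)) ⟩
  ∑[ ε ∈ allEps ] (𝟙 (eqEps x ε) * f ε + + cnt τ ε * f ε)
    ≡⟨ ∑-cong allEps (λ ε → trans (sym (ℤ.*-distribʳ-+ (f ε) (𝟙 (eqEps x ε)) (+ cnt τ ε)))
                                  (cong (_* f ε) (sym (ℤ.pos-+ (b2ℕ (eqEps x ε)) (cnt τ ε))))) ⟩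
  ∑[ ε ∈ allEps ] (+ cnt (x ∷ τ) ε * f ε) ∎
  where open ≡-Reasoning

∏-lookup : ∀ {n} (τ : Vec Eps n) (f : Eps → ℤ) →
           ∏[ j ∈ allFin n ] f (lookup τ j) ≡ ∏[ ε ∈ allEps ] (f ε ^ cnt τ ε)
∏-lookup []          f = refl
∏-lookup {suc n} (x ∷ τ) f = begin
  ∏[ j ∈ allFin (suc n) ] f (lookup (x ∷ τ) j)
    ≡⟨ ∏-allFin-suc n (f ∘ lookup (x ∷ τ)) ⟩
  f x * (∏[ j ∈ allFin n ] f (lookup τ j))
    ≡⟨ cong₂ _*_ (sym (∏-eqEps x f)) (∏-lookup τ f) ⟩
  (∏[ ε ∈ allEps ] (f ε ^ b2ℕ (eqEps x ε))) * (∏[ ε ∈ allEps ] (f ε ^ cnt τ ε))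
    ≡⟨ sym (∏-distrib-* allEps (λ ε → f ε ^ b2ℕ (eqEps x ε)) (λ ε → f ε ^ cnt τ ε)) ⟩
  ∏[ ε ∈ allEps ] (f ε ^ b2ℕ (eqEps x ε) * f ε ^ cnt τ ε)
    ≡⟨ ∏-cong allEps (λ ε → sym (ℤ.^-distribˡ-+-* (f ε) (b2ℕ (eqEps x ε)) (cnt τ ε))) ⟩
  ∏[ ε ∈ allEps ] (f ε ^ cnt (x ∷ τ) ε) ∎
  where open ≡-Reasoning

shifted : (Eps → ℕ) → Eps → Eps → ℤ
shifted s ε ε′ = + s ε′ - unit ε ε′ + unit e111 ε′

unit≡𝟙 : ∀ x ε → unit x ε ≡ 𝟙 (eqEps x ε)
unit≡𝟙 x ε with eqEps x ε
... | true  = refl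
... | false = refl

faceSum : (Eps → Bool) → (Eps → ℤ) → ℤ
faceSum p t = ∑ (filterᵇ p allEps) t

∑-others≡faceSum : ∀ {n} (τ : Vec Eps n) (j : Fin n) (p : Eps → Bool) → p e111 ≡ false →
  ∑[ a ∈ allFin n ] (𝟙 (p (lookup τ a)) * 𝟙 (not ⌊ j ≟ a ⌋)) ≡ faceSum p (shifted (cnt τ) (lookup τ j))
∑-others≡faceSum {n} τ j p p111 = begin
  ∑[ a ∈ allFin n ] (h (lookup τ a) * 𝟙 (not ⌊ j ≟ a ⌋))
    ≡⟨ ∑-cong (allFin n) (λ a → trans (cong (h (lookup τ a) *_) (𝟙-not ⌊ j ≟ a ⌋)) (except (h (lookup τ a)) (δ j a))) ⟩
  ∑[ a ∈ allFin n ] (h (lookup τ a) + -1ℤ * (δ j a * h (lookup τ a)))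
    ≡⟨ ∑-distrib-+ (allFin n) (h ∘ lookup τ) (λ a → -1ℤ * (δ j a * h (lookup τ a))) ⟩
  (∑[ a ∈ allFin n ] h (lookup τ a)) + (∑[ a ∈ allFin n ] (-1ℤ * (δ j a * h (lookup τ a))))
    ≡⟨ cong₂ _+_ (∑-lookup τ h) (trans (sym (∑-distribˡ -1ℤ (allFin n) (λ a → δ j a * h (lookup τ a))))
                                       (cong (-1ℤ *_) (∑-δ j (h ∘ lookup τ)))) ⟩
  ∑ allEps C + -1ℤ * h (lookup τ j)
    ≡⟨ cong (_+_ (∑ allEps C)) (sym (trans (cong₂ _+_ (cong (-1ℤ *_) (∑-eqEps (lookup τ j) h))
                                                         (trans (∑-eqEps e111 h) (cong 𝟙 p111)))
                                            (ℤ.+-identityʳ _))) ⟩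
  ∑ allEps C + (-1ℤ * ∑ allEps U + ∑ allEps V)
    ≡⟨ cong (_+_ (∑ allEps C)) (trans (cong (_+ ∑ allEps V) (∑-distribˡ -1ℤ allEps U))
                                      (sym (∑-distrib-+ allEps (λ ε → -1ℤ * U ε) V))) ⟩
  ∑ allEps C + (∑[ ε ∈ allEps ] (-1ℤ * U ε + V ε))
    ≡⟨ sym (∑-distrib-+ allEps C (λ ε → -1ℤ * U ε + V ε)) ⟩
  ∑[ ε ∈ allEps ] (C ε + (-1ℤ * U ε + V ε))
    ≡⟨ ∑-cong allEps (λ ε → trans (collect (+ cnt τ ε) (𝟙 (eqEps (lookup τ j) ε)) (𝟙 (eqEps e111 ε)) (h ε))
         (cong (h ε *_) (sym (cong₂ (λ u v → + cnt τ ε - u + v) (unit≡𝟙 (lookup τ j) ε) (unit≡𝟙 e111 ε))))) ⟩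
  ∑[ ε ∈ allEps ] (h ε * shifted (cnt τ) (lookup τ j) ε)
    ≡⟨ ∑-filterᵇ p allEps (shifted (cnt τ) (lookup τ j)) ⟩
  faceSum p (shifted (cnt τ) (lookup τ j)) ∎
  where
  open ≡-Reasoning
  h C U V : Eps → ℤ
  h = 𝟙 ∘ p
  C ε = + cnt τ ε * h ε
  U ε = 𝟙 (eqEps (lookup τ j) ε) * h ε
  V ε = 𝟙 (eqEps e111 ε) * h ε
  except : ∀ x d → x * (+ 1 - d) ≡ x + -1ℤ * (d * x)
  except = solve-∀
  collect : ∀ c u v x → c * x + (-1ℤ * (u * x) + v * x) ≡ x * (c - u + v)
  collect = solve-∀

g4-form-cong : ∀ {a a′ b b′ c c′ d d′ e e′ f f′ g g′} → a ≡ a′ → b ≡ b′ → c ≡ c′ → d ≡ d′ → e ≡ e′ → f ≡ f′ → g ≡ g′ →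
               g4-form a b c d e f g ≡ g4-form a′ b′ c′ d′ e′ f′ g′
g4-form-cong refl refl refl refl refl refl refl = refl

-- The linear forms f₁, …, f₁₂₃ of g4 are the sums of t over the faces {ε_i = 0} of the cube.
g4≡g4-form-faceSums : ∀ t →
  g4 t ≡ g4-form (faceSum off₁ t) (faceSum off₂ t) (faceSum off₃ t)
                 (faceSum (λ ε → off₁ ε ∧ off₂ ε) t) (faceSum (λ ε → off₁ ε ∧ off₃ ε) t)
                 (faceSum (λ ε → off₂ ε ∧ off₃ ε) t) (faceSum (λ ε → off₁ ε ∧ off₂ ε ∧ off₃ ε) t)
g4≡g4-form-faceSums t = sym (g4-form-cong
  (square t₀₀₀ t₀₀₁ t₀₁₀ t₀₁₁) (square t₀₀₀ t₀₀₁ t₁₀₀ t₁₀₁) (square t₀₀₀ t₀₁₀ t₁₀₀ t₁₁₀)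
  (edge t₀₀₀ t₀₀₁) (edge t₀₀₀ t₀₁₀) (edge t₀₀₀ t₁₀₀) (ℤ.+-identityʳ t₀₀₀))
  where
  t₀₀₀ t₀₀₁ t₀₁₀ t₀₁₁ t₁₀₀ t₁₀₁ t₁₁₀ : ℤ
  t₀₀₀ = t (false , false , false)
  t₀₀₁ = t (false , false , true)
  t₀₁₀ = t (false , true , false)
  t₀₁₁ = t (false , true , true)
  t₁₀₀ = t (true , false , false)
  t₁₀₁ = t (true , false , true)
  t₁₁₀ = t (true , true , false)
  square : ∀ w x y z → w + (x + (y + (z + + 0))) ≡ w + y + x + z
  square = solve-∀
  edge : ∀ x y → x + (y + + 0) ≡ x + y
  edge = solve-∀

𝟙-∧-idem-weight : ∀ x y {v} → v * v ≡ v → 𝟙 x * v * (𝟙 y * v) ≡ 𝟙 (x ∧ y) * v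
𝟙-∧-idem-weight x y {v} v²≡v = trans (shuffle (𝟙 x) (𝟙 y) v) (cong₂ _*_ (sym (𝟙-∧ x y)) v²≡v)
  where
  shuffle : ∀ x y v → x * v * (y * v) ≡ x * y * (v * v)
  shuffle = solve-∀

column-sum : ∀ {n} (τ : Vec Eps n) (j : Fin n) →
  ∑³ (allFin n) (λ a b c → allowed τ a b c * 𝟙 (distinct (j ∷ a ∷ b ∷ c ∷ []))) ≡ g4 (shifted (cnt τ) (lookup τ j))
column-sum {n} τ j = begin
  ∑³ (allFin n) (λ a b c → allowed τ a b c * 𝟙 (distinct (j ∷ a ∷ b ∷ c ∷ [])))
    ≡⟨ ∑³-cong (allFin n) (λ a b c → trans (cong (allowed τ a b c *_) (𝟙-distinct-∷ j (a ∷ b ∷ c ∷ [])))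
         (regroup (𝟙 (off₁ (lookup τ a))) (𝟙 (off₂ (lookup τ b))) (𝟙 (off₃ (lookup τ c)))
                  (ν a) (ν b) (ν c) (𝟙 (distinct (a ∷ b ∷ c ∷ []))))) ⟩
  ∑³ (allFin n) (λ a b c → α a * β b * γ c * 𝟙 (distinct (a ∷ b ∷ c ∷ [])))
    ≡⟨ ∑-distinct-triples α β γ ⟩
  g4-form (S α) (S β) (S γ) (S (λ a → α a * β a)) (S (λ a → α a * γ a)) (S (λ a → β a * γ a))
          (S (λ a → α a * β a * γ a))
    ≡⟨ g4-form-cong (on-face off₁ refl) (on-face off₂ refl) (on-face off₃ refl)
         (trans (∑-cong (allFin n) (λ a → 𝟙-∧-idem-weight (off₁ (lookup τ a)) (off₂ (lookup τ a)) (ν-idem a)))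
                (on-face (λ ε → off₁ ε ∧ off₂ ε) refl))
         (trans (∑-cong (allFin n) (λ a → 𝟙-∧-idem-weight (off₁ (lookup τ a)) (off₃ (lookup τ a)) (ν-idem a)))
                (on-face (λ ε → off₁ ε ∧ off₃ ε) refl))
         (trans (∑-cong (allFin n) (λ a → 𝟙-∧-idem-weight (off₂ (lookup τ a)) (off₃ (lookup τ a)) (ν-idem a)))
                (on-face (λ ε → off₂ ε ∧ off₃ ε) refl))
         (trans (∑-cong (allFin n) (λ a → ∧³-weight (off₁ (lookup τ a)) (off₂ (lookup τ a)) (off₃ (lookup τ a)) a))
                (on-face (λ ε → off₁ ε ∧ off₂ ε ∧ off₃ ε) refl)) ⟩
  g4-form (faceSum off₁ t) (faceSum off₂ t) (faceSum off₃ t)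
          (faceSum (λ ε → off₁ ε ∧ off₂ ε) t) (faceSum (λ ε → off₁ ε ∧ off₃ ε) t)
          (faceSum (λ ε → off₂ ε ∧ off₃ ε) t) (faceSum (λ ε → off₁ ε ∧ off₂ ε ∧ off₃ ε) t)
    ≡⟨ sym (g4≡g4-form-faceSums t) ⟩
  g4 t ∎
  where
  open ≡-Reasoning
  t : Eps → ℤ
  t = shifted (cnt τ) (lookup τ j)
  S : (Fin n → ℤ) → ℤ
  S = ∑ (allFin n)
  ν : Fin n → ℤ
  ν a = 𝟙 (not ⌊ j ≟ a ⌋)
  ν-idem : ∀ a → ν a * ν a ≡ ν a
  ν-idem a = 𝟙-idem (not ⌊ j ≟ a ⌋)
  α β γ : Fin n → ℤ
  α a = 𝟙 (off₁ (lookup τ a)) * ν a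
  β a = 𝟙 (off₂ (lookup τ a)) * ν a
  γ a = 𝟙 (off₃ (lookup τ a)) * ν a
  on-face : ∀ (p : Eps → Bool) → p e111 ≡ false → S (λ a → 𝟙 (p (lookup τ a)) * ν a) ≡ faceSum p t
  on-face = ∑-others≡faceSum τ j
  ∧³-weight : ∀ x y z a → 𝟙 x * ν a * (𝟙 y * ν a) * (𝟙 z * ν a) ≡ 𝟙 (x ∧ y ∧ z) * ν a
  ∧³-weight x y z a = begin
    𝟙 x * ν a * (𝟙 y * ν a) * (𝟙 z * ν a) ≡⟨ cong (_* (𝟙 z * ν a)) (𝟙-∧-idem-weight x y (ν-idem a)) ⟩
    𝟙 (x ∧ y) * ν a * (𝟙 z * ν a)        ≡⟨ 𝟙-∧-idem-weight (x ∧ y) z (ν-idem a) ⟩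
    𝟙 ((x ∧ y) ∧ z) * ν a                ≡⟨ cong (λ b → 𝟙 b * ν a) (∧-assoc x y z) ⟩
    𝟙 (x ∧ y ∧ z) * ν a                  ∎
  regroup : ∀ x y z u v w d → x * y * z * (u * (v * (w * + 1)) * d) ≡ x * u * (y * v) * (z * w) * d
  regroup = solve-∀

-- Multinomial coefficients

∑-𝟙-eqEps : ∀ x → ∑[ ε ∈ allEps ] 𝟙 (eqEps x ε) ≡ + 1
∑-𝟙-eqEps x = trans (∑-cong allEps (λ ε → sym (ℤ.*-identityʳ (𝟙 (eqEps x ε))))) (∑-eqEps x (λ _ → + 1))

sum-cnt : ∀ {n} (τ : Vec Eps n) → sumℕ (map (cnt τ) allEps) ≡ n
sum-cnt []      = refl
sum-cnt (x ∷ τ) = ℤ.+-injective (begin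
  + sumℕ (map (cnt (x ∷ τ)) allEps)                               ≡⟨ +-sum allEps (cnt (x ∷ τ)) ⟩
  ∑[ ε ∈ allEps ] (𝟙 (eqEps x ε) + + cnt τ ε)                    ≡⟨ ∑-distrib-+ allEps (𝟙 ∘ eqEps x) (λ ε → + cnt τ ε) ⟩
  (∑[ ε ∈ allEps ] 𝟙 (eqEps x ε)) + (∑[ ε ∈ allEps ] + cnt τ ε)  ≡⟨ cong₂ _+_ (∑-𝟙-eqEps x) (sym (+-sum allEps (cnt τ))) ⟩
  + 1 + + sumℕ (map (cnt τ) allEps)                               ≡⟨ cong (λ m → + 1 + + m) (sum-cnt τ) ⟩
  + suc _                                                         ∎)
  where open ≡-Reasoning

hasCounts : ∀ {n} → Vec Eps n → (Eps → ℕ) → Bool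
hasCounts τ s = all (λ ε → cnt τ ε ≡ᵇ s ε) allEps

#words : ℕ → (Eps → ℕ) → ℤ
#words n s = ∑[ τ ∈ allVecs allEps n ] 𝟙 (hasCounts τ s)

-- s − e_x (truncated at 0)
remove : Eps → (Eps → ℕ) → Eps → ℕ
remove x s ε = s ε ∸ b2ℕ (eqEps x ε)

𝟙-hasCounts-∷ : ∀ {n} x (τ : Vec Eps n) s →
                𝟙 (hasCounts (x ∷ τ) s) ≡ 𝟙 (0 <ᵇ s x) * 𝟙 (hasCounts τ (remove x s))
𝟙-hasCounts-∷ x τ s = begin
  𝟙 (hasCounts (x ∷ τ) s)
    ≡⟨ 𝟙-all (λ ε → cnt (x ∷ τ) ε ≡ᵇ s ε) allEps ⟩
  ∏[ ε ∈ allEps ] 𝟙 ((b2ℕ (eqEps x ε) ℕ.+ cnt τ ε) ≡ᵇ s ε)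
    ≡⟨ ∏-cong allEps (λ ε → split (eqEps x ε) (cnt τ ε) (s ε)) ⟩
  ∏[ ε ∈ allEps ] (𝟙 (0 <ᵇ s ε) ^ b2ℕ (eqEps x ε) * 𝟙 (cnt τ ε ≡ᵇ remove x s ε))
    ≡⟨ ∏-distrib-* allEps (λ ε → 𝟙 (0 <ᵇ s ε) ^ b2ℕ (eqEps x ε)) (λ ε → 𝟙 (cnt τ ε ≡ᵇ remove x s ε)) ⟩
  (∏[ ε ∈ allEps ] (𝟙 (0 <ᵇ s ε) ^ b2ℕ (eqEps x ε))) * (∏[ ε ∈ allEps ] 𝟙 (cnt τ ε ≡ᵇ remove x s ε))
    ≡⟨ cong₂ _*_ (∏-eqEps x (λ ε → 𝟙 (0 <ᵇ s ε))) (sym (𝟙-all (λ ε → cnt τ ε ≡ᵇ remove x s ε) allEps)) ⟩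
  𝟙 (0 <ᵇ s x) * 𝟙 (hasCounts τ (remove x s)) ∎
  where
  open ≡-Reasoning
  split : ∀ b c a → 𝟙 ((b2ℕ b ℕ.+ c) ≡ᵇ a) ≡ 𝟙 (0 <ᵇ a) ^ b2ℕ b * 𝟙 (c ≡ᵇ a ∸ b2ℕ b)
  split false c a       = sym (ℤ.*-identityˡ _)
  split true  c zero    = refl
  split true  c (suc a) = sym (ℤ.*-identityˡ _)

#words-suc : ∀ n s → #words (suc n) s ≡ ∑[ x ∈ allEps ] (𝟙 (0 <ᵇ s x) * #words n (remove x s))
#words-suc n s = begin
  #words (suc n) s
    ≡⟨ ∑-allVecs-suc allEps n (λ τ → 𝟙 (hasCounts τ s)) ⟩
  ∑[ x ∈ allEps ] ∑[ τ ∈ allVecs allEps n ] 𝟙 (hasCounts (x ∷ τ) s)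
    ≡⟨ ∑-cong allEps (λ x → trans (∑-cong (allVecs allEps n) (λ τ → 𝟙-hasCounts-∷ x τ s))
                                  (sym (∑-distribˡ (𝟙 (0 <ᵇ s x)) (allVecs allEps n) _))) ⟩
  ∑[ x ∈ allEps ] (𝟙 (0 <ᵇ s x) * #words n (remove x s)) ∎
  where open ≡-Reasoning

+-prodFact : ∀ (s : A → ℕ) xs → + prodFact (map s xs) ≡ ∏[ x ∈ xs ] + (s x !)
+-prodFact s []       = refl
+-prodFact s (x ∷ xs) = trans (ℤ.pos-* (s x !) _) (cong (+ (s x !) *_) (+-prodFact s xs))

∏!-remove : ∀ x s {m} → s x ≡ suc m → ∏[ ε ∈ allEps ] + (s ε !) ≡ + s x * (∏[ ε ∈ allEps ] + (remove x s ε !))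
∏!-remove x s {m} sₓ≡1+m = begin
  ∏[ ε ∈ allEps ] + (s ε !)
    ≡⟨ ∏-cong allEps peel ⟩
  ∏[ ε ∈ allEps ] ((+ s x) ^ b2ℕ (eqEps x ε) * + (remove x s ε !))
    ≡⟨ ∏-distrib-* allEps (λ ε → (+ s x) ^ b2ℕ (eqEps x ε)) (λ ε → + (remove x s ε !)) ⟩
  (∏[ ε ∈ allEps ] ((+ s x) ^ b2ℕ (eqEps x ε))) * (∏[ ε ∈ allEps ] + (remove x s ε !))
    ≡⟨ cong (_* (∏[ ε ∈ allEps ] + (remove x s ε !))) (∏-eqEps x (λ _ → + s x)) ⟩
  + s x * (∏[ ε ∈ allEps ] + (remove x s ε !)) ∎
  where
  open ≡-Reasoning
  peel : ∀ ε → + (s ε !) ≡ (+ s x) ^ b2ℕ (eqEps x ε) * + (remove x s ε !)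
  peel ε with eqEps x ε in x≟ε
  ... | false = sym (ℤ.*-identityˡ _)
  ... | true with refl ← eqEps-sound x ε (subst T (sym x≟ε) tt) rewrite sₓ≡1+m =
    trans (ℤ.pos-* (suc m) (m !)) (cong (_* + (m !)) (sym (ℤ.*-identityʳ (+ suc m))))

sum-remove : ∀ x s {m} → s x ≡ suc m → sumℕ (map s allEps) ≡ suc (sumℕ (map (remove x s) allEps))
sum-remove x s {m} sₓ≡1+m = ℤ.+-injective (begin
  + sumℕ (map s allEps)                                    ≡⟨ +-sum allEps s ⟩
  ∑[ ε ∈ allEps ] + s ε                                    ≡⟨ ∑-cong allEps peel ⟩
  ∑[ ε ∈ allEps ] (𝟙 (eqEps x ε) + + remove x s ε)         ≡⟨ ∑-distrib-+ allEps (𝟙 ∘ eqEps x) (λ ε → + remove x s ε) ⟩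
  (∑[ ε ∈ allEps ] 𝟙 (eqEps x ε)) + (∑[ ε ∈ allEps ] + remove x s ε)
                                                           ≡⟨ cong₂ _+_ (∑-𝟙-eqEps x) (sym (+-sum allEps (remove x s))) ⟩
  + suc (sumℕ (map (remove x s) allEps))                   ∎)
  where
  open ≡-Reasoning
  peel : ∀ ε → + s ε ≡ 𝟙 (eqEps x ε) + + remove x s ε
  peel ε with eqEps x ε in x≟ε
  ... | false = refl
  ... | true with refl ← eqEps-sound x ε (subst T (sym x≟ε) tt) rewrite sₓ≡1+m = refl

sum≡0⇒all-zero : ∀ (s : A → ℕ) xs → sumℕ (map s xs) ≡ 0 →
                 𝟙 (all (λ x → 0 ≡ᵇ s x) xs) ≡ + 1 × ∏[ x ∈ xs ] + (s x !) ≡ + 1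
sum≡0⇒all-zero s []       _  = refl , refl
sum≡0⇒all-zero s (x ∷ xs) Σ≡0 with s x
... | zero = let all-zero , ∏!≡1 = sum≡0⇒all-zero s xs Σ≡0 in all-zero , trans (ℤ.*-identityˡ _) ∏!≡1

#words-multinomial : ∀ n s → sumℕ (map s allEps) ≡ n → #words n s * (∏[ ε ∈ allEps ] + (s ε !)) ≡ + (n !)
#words-multinomial zero s Σ≡0 =
  let all-zero , ∏!≡1 = sum≡0⇒all-zero s allEps Σ≡0 in cong₂ _*_ (trans (ℤ.+-identityʳ _) all-zero) ∏!≡1
#words-multinomial (suc n) s Σ≡1+n = begin
  #words (suc n) s * ∏! s
    ≡⟨ cong (_* ∏! s) (#words-suc n s) ⟩
  (∑[ x ∈ allEps ] (𝟙 (0 <ᵇ s x) * #words n (remove x s))) * ∏! s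
    ≡⟨ ∑-distribʳ (∏! s) allEps (λ x → 𝟙 (0 <ᵇ s x) * #words n (remove x s)) ⟩
  ∑[ x ∈ allEps ] (𝟙 (0 <ᵇ s x) * #words n (remove x s) * ∏! s)
    ≡⟨ ∑-cong allEps term ⟩
  ∑[ x ∈ allEps ] (+ s x * + (n !))
    ≡⟨ sym (∑-distribʳ (+ (n !)) allEps (λ x → + s x)) ⟩
  (∑[ x ∈ allEps ] + s x) * + (n !)
    ≡⟨ cong (_* + (n !)) (trans (sym (+-sum allEps s)) (cong +_ Σ≡1+n)) ⟩
  + suc n * + (n !)
    ≡⟨ sym (ℤ.pos-* (suc n) (n !)) ⟩
  + (suc n !) ∎
  where
  open ≡-Reasoning
  ∏! : (Eps → ℕ) → ℤ
  ∏! s = ∏[ ε ∈ allEps ] + (s ε !)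
  term : ∀ x → 𝟙 (0 <ᵇ s x) * #words n (remove x s) * ∏! s ≡ + s x * + (n !)
  term x with s x in sₓ≡
  ... | zero  = refl
  ... | suc m = begin
    + 1 * #words n (remove x s) * ∏! s
      ≡⟨ cong₂ _*_ (ℤ.*-identityˡ (#words n (remove x s))) (∏!-remove x s sₓ≡) ⟩
    #words n (remove x s) * (+ s x * ∏! (remove x s))
      ≡⟨ reorder (#words n (remove x s)) (+ s x) (∏! (remove x s)) ⟩
    + s x * (#words n (remove x s) * ∏! (remove x s))
      ≡⟨ cong₂ _*_ (cong +_ sₓ≡) IH ⟩
    + suc m * + (n !) ∎
    where
    IH = #words-multinomial n (remove x s) (ℕ.suc-injective (trans (sym (sum-remove x s sₓ≡)) Σ≡1+n))
    reorder : ∀ a b c → a * (b * c) ≡ b * (a * c)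
    reorder = solve-∀

-- Grouping words by letter counts

∑-upTo-suc : ∀ m (f : ℕ → ℤ) → ∑ (upTo (suc m)) f ≡ f 0 + (∑[ i ∈ upTo m ] f (suc i))
∑-upTo-suc m f = cong sumℤ (trans (List.map-applyUpTo id f (suc m))
                                  (cong (f 0 ∷_) (sym (List.map-applyUpTo id (f ∘ suc) m))))

∑-upTo-cong : ∀ m {f g : ℕ → ℤ} → (∀ i → i < m → f i ≡ g i) → ∑ (upTo m) f ≡ ∑ (upTo m) g
∑-upTo-cong zero    f≗g = refl
∑-upTo-cong (suc m) {f} {g} f≗g = begin
  ∑ (upTo (suc m)) f                  ≡⟨ ∑-upTo-suc m f ⟩
  f 0 + (∑[ i ∈ upTo m ] f (suc i))   ≡⟨ cong₂ _+_ (f≗g 0 (s≤s z≤n)) (∑-upTo-cong m (λ i i<m → f≗g (suc i) (s≤s i<m))) ⟩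
  g 0 + (∑[ i ∈ upTo m ] g (suc i))   ≡⟨ sym (∑-upTo-suc m g) ⟩
  ∑ (upTo (suc m)) g                  ∎
  where open ≡-Reasoning

∑-δ-upTo : ∀ m a (f : ℕ → ℤ) → a < m → ∑[ i ∈ upTo m ] (𝟙 (a ≡ᵇ i) * f i) ≡ f a
∑-δ-upTo (suc m) zero    f _ = begin
  ∑[ i ∈ upTo (suc m) ] (𝟙 (0 ≡ᵇ i) * f i)  ≡⟨ ∑-upTo-suc m (λ i → 𝟙 (0 ≡ᵇ i) * f i) ⟩
  + 1 * f 0 + (∑[ i ∈ upTo m ] + 0)        ≡⟨ cong₂ _+_ (ℤ.*-identityˡ (f 0)) (∑-zero (upTo m)) ⟩
  f 0 + + 0                                ≡⟨ ℤ.+-identityʳ (f 0) ⟩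
  f 0                                      ∎
  where open ≡-Reasoning
∑-δ-upTo (suc m) (suc a) f (s≤s a<m) =
  trans (∑-upTo-suc m (λ i → 𝟙 (suc a ≡ᵇ i) * f i)) (trans (ℤ.+-identityˡ _) (∑-δ-upTo m a (f ∘ suc) a<m))

∑-compositions-suc : ∀ k n (F : Vec ℕ (suc k) → ℤ) →
  ∑ (compositions (suc k) n) F ≡ ∑[ i ∈ upTo (suc n) ] ∑[ v ∈ compositions k (n ∸ i) ] F (i ∷ v)
∑-compositions-suc k n F = trans (∑-concatMap (λ i → map (i ∷_) (compositions k (n ∸ i))) (upTo (suc n)) F)
  (∑-cong (upTo (suc n)) (λ i → ∑-map (i ∷_) (compositions k (n ∸ i)) F))

∑-compositions-cong : ∀ k n {F G : Vec ℕ k → ℤ} → (∀ v → Vec.sum v ≡ n → F v ≡ G v) →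
                      ∑ (compositions k n) F ≡ ∑ (compositions k n) G
∑-compositions-cong zero    zero    F≗G = cong (_+ + 0) (F≗G [] refl)
∑-compositions-cong zero    (suc n) F≗G = refl
∑-compositions-cong (suc k) n {F} {G} F≗G = begin
  ∑ (compositions (suc k) n) F
    ≡⟨ ∑-compositions-suc k n F ⟩
  ∑[ i ∈ upTo (suc n) ] ∑[ v ∈ compositions k (n ∸ i) ] F (i ∷ v)
    ≡⟨ ∑-upTo-cong (suc n) (λ i i≤n → ∑-compositions-cong k (n ∸ i)
         (λ v Σv≡n∸i → F≗G (i ∷ v) (trans (cong (i ℕ.+_) Σv≡n∸i) (ℕ.m+[n∸m]≡n (ℕ.≤-pred i≤n))))) ⟩
  ∑[ i ∈ upTo (suc n) ] ∑[ v ∈ compositions k (n ∸ i) ] G (i ∷ v)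
    ≡⟨ sym (∑-compositions-suc k n G) ⟩
  ∑ (compositions (suc k) n) G ∎
  where open ≡-Reasoning

δℕ : ∀ {k} → Vec ℕ k → Vec ℕ k → ℤ
δℕ []      []      = + 1
δℕ (a ∷ u) (b ∷ v) = 𝟙 (a ≡ᵇ b) * δℕ u v

∑-δ-compositions : ∀ k n (u : Vec ℕ k) → Vec.sum u ≡ n → (G : Vec ℕ k → ℤ) →
                   ∑[ v ∈ compositions k n ] (δℕ u v * G v) ≡ G u
∑-δ-compositions zero .0 [] refl G = trans (ℤ.+-identityʳ _) (ℤ.*-identityˡ (G []))
∑-δ-compositions (suc k) n (a ∷ u) Σ≡n G = begin
  ∑[ v ∈ compositions (suc k) n ] (δℕ (a ∷ u) v * G v)
    ≡⟨ ∑-compositions-suc k n (λ v → δℕ (a ∷ u) v * G v) ⟩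
  ∑[ i ∈ upTo (suc n) ] ∑[ v ∈ compositions k (n ∸ i) ] (𝟙 (a ≡ᵇ i) * δℕ u v * G (i ∷ v))
    ≡⟨ ∑-cong (upTo (suc n)) (λ i → trans (∑-cong (compositions k (n ∸ i)) (λ v → ℤ.*-assoc (𝟙 (a ≡ᵇ i)) _ _))
                                          (sym (∑-distribˡ (𝟙 (a ≡ᵇ i)) (compositions k (n ∸ i)) _))) ⟩
  ∑[ i ∈ upTo (suc n) ] (𝟙 (a ≡ᵇ i) * (∑[ v ∈ compositions k (n ∸ i) ] (δℕ u v * G (i ∷ v))))
    ≡⟨ ∑-δ-upTo (suc n) a (λ i → ∑[ v ∈ compositions k (n ∸ i) ] (δℕ u v * G (i ∷ v))) (s≤s a≤n) ⟩
  ∑[ v ∈ compositions k (n ∸ a) ] (δℕ u v * G (a ∷ v))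
    ≡⟨ ∑-δ-compositions k (n ∸ a) u Σu≡n∸a (G ∘ (a ∷_)) ⟩
  G (a ∷ u) ∎
  where
  open ≡-Reasoning
  a≤n : a ℕ.≤ n
  a≤n = subst (a ℕ.≤_) Σ≡n (ℕ.m≤m+n a (Vec.sum u))
  Σu≡n∸a : Vec.sum u ≡ n ∸ a
  Σu≡n∸a = sym (trans (cong (_∸ a) (sym Σ≡n)) (ℕ.m+n∸m≡n a (Vec.sum u)))

countVec : ∀ {n} → Vec Eps n → Vec ℕ 8
countVec τ = Vec.map (cnt τ) (Vec.fromList allEps)

δℕ-countVec : ∀ {n} (τ : Vec Eps n) v → δℕ (countVec τ) v ≡ 𝟙 (hasCounts τ (toEpsVec v))
δℕ-countVec τ v@(_ ∷ _ ∷ _ ∷ _ ∷ _ ∷ _ ∷ _ ∷ _ ∷ []) = sym (𝟙-all (λ ε → cnt τ ε ≡ᵇ toEpsVec v ε) allEps)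

sum-toEpsVec : ∀ v → sumℕ (map (toEpsVec v) allEps) ≡ Vec.sum v
sum-toEpsVec (_ ∷ _ ∷ _ ∷ _ ∷ _ ∷ _ ∷ _ ∷ _ ∷ []) = refl

∑-by-counts : ∀ n (G : Vec ℕ 8 → ℤ) →
  ∑[ τ ∈ allVecs allEps n ] G (countVec τ) ≡ ∑[ v ∈ compositions 8 n ] (#words n (toEpsVec v) * G v)
∑-by-counts n G = begin
  ∑[ τ ∈ allVecs allEps n ] G (countVec τ)
    ≡⟨ ∑-cong (allVecs allEps n) (λ τ → sym (∑-δ-compositions 8 n (countVec τ) (sum-cnt τ) G)) ⟩
  ∑[ τ ∈ allVecs allEps n ] ∑[ v ∈ compositions 8 n ] (δℕ (countVec τ) v * G v)
    ≡⟨ ∑-comm (allVecs allEps n) (compositions 8 n) (λ τ v → δℕ (countVec τ) v * G v) ⟩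
  ∑[ v ∈ compositions 8 n ] ∑[ τ ∈ allVecs allEps n ] (δℕ (countVec τ) v * G v)
    ≡⟨ ∑-cong (compositions 8 n) (λ v →
         trans (sym (∑-distribʳ (G v) (allVecs allEps n) (λ τ → δℕ (countVec τ) v)))
               (cong (_* G v) (∑-cong (allVecs allEps n) (λ τ → δℕ-countVec τ v)))) ⟩
  ∑[ v ∈ compositions 8 n ] (#words n (toEpsVec v) * G v) ∎
  where open ≡-Reasoning

multinomial≡#words : ∀ n s → sumℕ (map s allEps) ≡ n → + multinomial n s ≡ #words n s
multinomial≡#words n s Σ≡n = begin
  + multinomial n s
    ≡⟨ cong +_ (trans (cong (λ m → (m ℕ./ prodFact (map s allEps)) {{nz}}) (sym c*∏!≡n!))
                      (DivMod.m*n/n≡m c (prodFact (map s allEps)) {{nz}})) ⟩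
  + c
    ≡⟨ +-sum (allVecs allEps n) (λ τ → b2ℕ (hasCounts τ s)) ⟩
  #words n s ∎
  where
  open ≡-Reasoning
  nz = prodFact≢0 (map s allEps)
  c : ℕ
  c = sumℕ (map (λ τ → b2ℕ (hasCounts τ s)) (allVecs allEps n))
  c*∏!≡n! : c ℕ.* prodFact (map s allEps) ≡ n !
  c*∏!≡n! = ℤ.+-injective (begin
    + (c ℕ.* prodFact (map s allEps))       ≡⟨ ℤ.pos-* c _ ⟩
    + c * + prodFact (map s allEps)         ≡⟨ cong₂ _*_ (+-sum (allVecs allEps n) (λ τ → b2ℕ (hasCounts τ s)))
                                                         (+-prodFact s allEps) ⟩
    #words n s * (∏[ ε ∈ allEps ] + (s ε !)) ≡⟨ #words-multinomial n s Σ≡n ⟩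
    + (n !)                                  ∎)

∏-^-sum : ∀ i (f : A → ℕ) xs → ∏[ x ∈ xs ] (i ^ f x) ≡ i ^ sumℕ (map f xs)
∏-^-sum i f []       = refl
∏-^-sum i f (x ∷ xs) = trans (cong (i ^ f x *_) (∏-^-sum i f xs)) (sym (ℤ.^-distribˡ-+-* i (f x) _))

∏-sign : ∀ (s : Eps → ℕ) → ∏[ ε ∈ allEps ] (sign ε ^ s ε) ≡ (- + 1) ^ sumℕ (map (λ ε → weight ε ℕ.* s ε) allEps)
∏-sign s = trans (∏-cong allEps (λ ε → ℤ.^-*-assoc (- + 1) (weight ε) (s ε)))
                 (∏-^-sum (- + 1) (λ ε → weight ε ℕ.* s ε) allEps)

weighted : (Eps → ℕ) → ℤ
weighted s = (- + 1) ^ sumℕ (map (λ ε → weight ε ℕ.* s ε) allEps) * (∏[ ε ∈ allEps ] (g4 (shifted s ε) ^ s ε))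

#words*weighted≡summand : ∀ n s → sumℕ (map s allEps) ≡ n → #words n s * weighted s ≡ summand n s
#words*weighted≡summand n s Σ≡n =
  trans (reorder (#words n s) σ p) (cong (λ m → σ * m * p) (sym (multinomial≡#words n s Σ≡n)))
  where
  σ p : ℤ
  σ = (- + 1) ^ sumℕ (map (λ ε → weight ε ℕ.* s ε) allEps)
  p = ∏[ ε ∈ allEps ] (g4 (shifted s ε) ^ s ε)
  reorder : ∀ w σ p → w * (σ * p) ≡ σ * w * p
  reorder = solve-∀

allRows : ∀ n → List (Vec (Fin n) n)
allRows n = allVecs (allFin n) n

𝟙-isReducedLatin : ∀ {n} (r₁ r₂ r₃ r₄ : Vec (Fin n) n) →
  𝟙 (isReducedLatin (r₁ ∷ r₂ ∷ r₃ ∷ r₄ ∷ []))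
  ≡ (∏[ j ∈ allFin n ] δ (lookup r₁ j) (lookup (Vec.allFin n) j))
    * (𝟙 (distinctRow r₁) * (𝟙 (distinctRow r₂) * 𝟙 (distinctRow r₃) * 𝟙 (distinctRow r₄)
       * (∏[ j ∈ allFin n ] 𝟙 (distinct (lookup r₁ j ∷ lookup r₂ j ∷ lookup r₃ j ∷ lookup r₄ j ∷ [])))))
𝟙-isReducedLatin {n} r₁ r₂ r₃ r₄ = begin
  𝟙 (isReducedLatin M)
    ≡⟨ 𝟙-∧ (isLatin M) (firstRowIdentity M) ⟩
  𝟙 (isLatin M) * 𝟙 (firstRowIdentity M)
    ≡⟨ cong₂ _*_ (𝟙-∧ (rowsDistinct M) (columnsDistinct M)) first-row ⟩
  𝟙 (rowsDistinct M) * 𝟙 (columnsDistinct M) * F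
    ≡⟨ cong₂ (λ x y → x * y * F) (𝟙-all (λ i → distinct (Vec.toList (lookup M i))) (allFin 4))
                                 (𝟙-all (λ j → distinct (Vec.toList (Vec.map (λ r → lookup r j) M))) (allFin n)) ⟩
  d r₁ * (d r₂ * (d r₃ * (d r₄ * + 1))) * C * F
    ≡⟨ reorder (d r₁) (d r₂) (d r₃) (d r₄) C F ⟩
  F * (d r₁ * (d r₂ * d r₃ * d r₄ * C)) ∎
  where
  open ≡-Reasoning
  M = r₁ ∷ r₂ ∷ r₃ ∷ r₄ ∷ []
  d : Vec (Fin n) n → ℤ
  d r = 𝟙 (distinctRow r)
  C F : ℤ
  C = ∏[ j ∈ allFin n ] 𝟙 (distinct (lookup r₁ j ∷ lookup r₂ j ∷ lookup r₃ j ∷ lookup r₄ j ∷ []))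
  F = ∏[ j ∈ allFin n ] δ (lookup r₁ j) (lookup (Vec.allFin n) j)
  first-row : 𝟙 (firstRowIdentity M) ≡ F
  first-row = trans (𝟙-all (λ j → ⌊ lookup r₁ j ≟ j ⌋) (allFin n))
    (∏-cong (allFin n) (λ j → cong (δ (lookup r₁ j)) (sym (Vec.lookup-allFin j))))
  reorder : ∀ a b c e C F → a * (b * (c * (e * + 1))) * C * F ≡ F * (a * (b * c * e * C))
  reorder = solve-∀

identity-row-distinct : ∀ n → 𝟙 (distinctRow (Vec.allFin n)) ≡ + 1
identity-row-distinct n = 𝟙-T (Equivalence.from (distinct⇔injective (Vec.allFin n))
  λ {i} {j} e → trans (sym (Vec.lookup-allFin i)) (trans e (Vec.lookup-allFin j)))

∑-allVecs-4 : ∀ (xs : List A) (F : Vec A 4 → ℤ) →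
  ∑ (allVecs xs 4) F ≡ ∑[ a ∈ xs ] ∑³ xs (λ b c d → F (a ∷ b ∷ c ∷ d ∷ []))
∑-allVecs-4 xs F =
  trans (∑-allVecs-suc xs 3 F) (∑-cong xs λ a →
  trans (∑-allVecs-suc xs 2 (λ v → F (a ∷ v))) (∑-cong xs λ b →
  trans (∑-allVecs-suc xs 1 (λ v → F (a ∷ b ∷ v))) (∑-cong xs λ c →
  trans (∑-allVecs-suc xs 0 (λ v → F (a ∷ b ∷ c ∷ v))) (∑-cong xs λ d → ℤ.+-identityʳ _))))

completesIdentity : ∀ {n} → Vec (Fin n) n → Vec (Fin n) n → Vec (Fin n) n → ℤ
completesIdentity {n} r₂ r₃ r₄ =
  𝟙 (distinctRow r₂) * 𝟙 (distinctRow r₃) * 𝟙 (distinctRow r₄)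
  * (∏[ j ∈ allFin n ] 𝟙 (distinct (j ∷ lookup r₂ j ∷ lookup r₃ j ∷ lookup r₄ j ∷ [])))

∑-reducedLatin≡∑-completesIdentity : ∀ n →
  ∑[ M ∈ allVecs (allRows n) 4 ] 𝟙 (isReducedLatin M) ≡ ∑³ (allRows n) completesIdentity
∑-reducedLatin≡∑-completesIdentity n = begin
  ∑[ M ∈ allVecs (allRows n) 4 ] 𝟙 (isReducedLatin M)
    ≡⟨ ∑-allVecs-4 (allRows n) (𝟙 ∘ isReducedLatin) ⟩
  ∑[ r₁ ∈ allRows n ] ∑³ (allRows n) (λ r₂ r₃ r₄ → 𝟙 (isReducedLatin (r₁ ∷ r₂ ∷ r₃ ∷ r₄ ∷ [])))
    ≡⟨ ∑-cong (allRows n) (λ r₁ → trans (∑³-cong (allRows n) (𝟙-isReducedLatin r₁))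
                                         (sym (∑³-distribˡ (first r₁) (allRows n) (G r₁)))) ⟩
  ∑[ r₁ ∈ allRows n ] (first r₁ * ∑³ (allRows n) (G r₁))
    ≡⟨ ∑-δ-allVecs (Vec.allFin n) (λ r₁ → ∑³ (allRows n) (G r₁)) ⟩
  ∑³ (allRows n) (G (Vec.allFin n))
    ≡⟨ ∑³-cong (allRows n) (λ r₂ r₃ r₄ → trans (cong (_* rest (Vec.allFin n) r₂ r₃ r₄) (identity-row-distinct n))
         (trans (ℤ.*-identityˡ (rest (Vec.allFin n) r₂ r₃ r₄))
                (cong (d r₂ * d r₃ * d r₄ *_) (∏-cong (allFin n) (λ j →
                  cong (λ i → 𝟙 (distinct (i ∷ lookup r₂ j ∷ lookup r₃ j ∷ lookup r₄ j ∷ []))) (Vec.lookup-allFin j)))))) ⟩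
  ∑³ (allRows n) completesIdentity ∎
  where
  open ≡-Reasoning
  first : Vec (Fin n) n → ℤ
  first r₁ = ∏[ j ∈ allFin n ] δ (lookup r₁ j) (lookup (Vec.allFin n) j)
  d : Vec (Fin n) n → ℤ
  d r = 𝟙 (distinctRow r)
  rest G : Vec (Fin n) n → Vec (Fin n) n → Vec (Fin n) n → Vec (Fin n) n → ℤ
  rest r₁ r₂ r₃ r₄ =
    d r₂ * d r₃ * d r₄ * (∏[ j ∈ allFin n ] 𝟙 (distinct (lookup r₁ j ∷ lookup r₂ j ∷ lookup r₃ j ∷ lookup r₄ j ∷ [])))
  G r₁ r₂ r₃ r₄ = d r₁ * rest r₁ r₂ r₃ r₄

sgn*∏g4≡weighted : ∀ {n} (τ : Vec Eps n) →
                   sgn τ * (∏[ j ∈ allFin n ] g4 (shifted (cnt τ) (lookup τ j))) ≡ weighted (cnt τ)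
sgn*∏g4≡weighted τ =
  cong₂ _*_ (trans (∏-lookup τ sign) (∏-sign (cnt τ))) (∏-lookup τ (λ ε → g4 (shifted (cnt τ) ε)))

∑-completesIdentity≡∑-weighted : ∀ n →
  ∑³ (allRows n) completesIdentity ≡ ∑[ τ ∈ allVecs allEps n ] weighted (cnt τ)
∑-completesIdentity≡∑-weighted n = begin
  ∑³ (allRows n) completesIdentity
    ≡⟨ ∑³-cong (allRows n) (λ r₂ r₃ r₄ → trans (cong (_* columns r₂ r₃ r₄) (inclusion-exclusion-rows r₂ r₃ r₄))
         (trans (∑-distribʳ (columns r₂ r₃ r₄) (allVecs allEps n) _)
                (∑-cong (allVecs allEps n) (λ τ → merge τ r₂ r₃ r₄)))) ⟩
  ∑³ (allRows n) (λ r₂ r₃ r₄ → ∑[ τ ∈ allVecs allEps n ] (sgn τ * Wᵗ τ r₂ r₃ r₄))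
    ≡⟨ ∑³-∑-comm (allRows n) (allVecs allEps n) _ ⟩
  ∑[ τ ∈ allVecs allEps n ] ∑³ (allRows n) (λ r₂ r₃ r₄ → sgn τ * Wᵗ τ r₂ r₃ r₄)
    ≡⟨ ∑-cong (allVecs allEps n) (λ τ → trans (sym (∑³-distribˡ (sgn τ) (allRows n) _))
                                              (cong (sgn τ *_) (∑³-∏-allVecs (allFin n) n (W τ)))) ⟩
  ∑[ τ ∈ allVecs allEps n ] (sgn τ * (∏[ j ∈ allFin n ] ∑³ (allFin n) (W τ j)))
    ≡⟨ ∑-cong (allVecs allEps n) (λ τ → trans (cong (sgn τ *_) (∏-cong (allFin n) (column-sum τ)))
                                              (sgn*∏g4≡weighted τ)) ⟩
  ∑[ τ ∈ allVecs allEps n ] weighted (cnt τ) ∎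
  where
  open ≡-Reasoning
  col : Fin n → Fin n → Fin n → Fin n → ℤ
  col j a b c = 𝟙 (distinct (j ∷ a ∷ b ∷ c ∷ []))
  columns : Vec (Fin n) n → Vec (Fin n) n → Vec (Fin n) n → ℤ
  columns r₂ r₃ r₄ = ∏[ j ∈ allFin n ] col j (lookup r₂ j) (lookup r₃ j) (lookup r₄ j)
  W : Vec Eps n → Fin n → Fin n → Fin n → Fin n → ℤ
  W τ j a b c = allowed τ a b c * col j a b c
  Wᵗ : Vec Eps n → Vec (Fin n) n → Vec (Fin n) n → Vec (Fin n) n → ℤ
  Wᵗ τ r₂ r₃ r₄ = ∏[ j ∈ allFin n ] W τ j (lookup r₂ j) (lookup r₃ j) (lookup r₄ j)
  merge : ∀ τ r₂ r₃ r₄ →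
    sgn τ * (∏[ j ∈ allFin n ] allowed τ (lookup r₂ j) (lookup r₃ j) (lookup r₄ j)) * columns r₂ r₃ r₄
    ≡ sgn τ * Wᵗ τ r₂ r₃ r₄
  merge τ r₂ r₃ r₄ = trans (ℤ.*-assoc (sgn τ) _ _) (cong (sgn τ *_) (sym (∏-distrib-* (allFin n) _ _)))

-- The formula holds for n = 0 as well.
mainTheorem3 : (n : ℕ) → 1 ≤ n →
    Σ ℕ (λ N → (ReducedLatinRect 4 n ↔ Fin N) × (+ N ≡ rhsR4 n))
mainTheorem3 n _ = N , Σ-T↔Fin-count {xs = matrices} matrices-enumerate isReducedLatin , (begin
  + N
    ≡⟨ +-sum matrices (b2ℕ ∘ isReducedLatin) ⟩
  ∑[ M ∈ matrices ] 𝟙 (isReducedLatin M)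
    ≡⟨ trans (∑-reducedLatin≡∑-completesIdentity n) (∑-completesIdentity≡∑-weighted n) ⟩
  ∑[ τ ∈ allVecs allEps n ] weighted (cnt τ)
    -- weighted only inspects its argument at the eight closed points of allEps, where
    -- toEpsVec (countVec τ) and cnt τ agree definitionally.
    ≡⟨ ∑-by-counts n (weighted ∘ toEpsVec) ⟩
  ∑[ v ∈ compositions 8 n ] (#words n (toEpsVec v) * weighted (toEpsVec v))
    ≡⟨ ∑-compositions-cong 8 n (λ v Σv≡n →
         #words*weighted≡summand n (toEpsVec v) (trans (sum-toEpsVec v) Σv≡n)) ⟩
  ∑[ v ∈ compositions 8 n ] summand n (toEpsVec v)
    ≡⟨ sym (∑-map toEpsVec (compositions 8 n) (summand n)) ⟩
  rhsR4 n ∎)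
  where
  open ≡-Reasoning
  matrices : List (Matrix 4 n)
  matrices = allVecs (allRows n) 4
  matrices-enumerate : Enumerates matrices
  matrices-enumerate =
    allVecs-enumerates {xs = allRows n} (allVecs-enumerates {xs = allFin n} (allFin-enumerates n) n) 4
  N : ℕ
  N = sumℕ (map (b2ℕ ∘ isReducedLatin) matrices)
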